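{- Let $g$ be a function defined by a non-deterministic register transducer with input alphabet $A$ and output alphabet $B$, and $f$ a function defined by a non-deterministic register transducer with input alphabet $B$ and output alphabet $C$. Then the composition $f\circ g:x\mapsto f(g(x))$ is effectively definable by a non-deterministic register transducer (with input alphabet $A$ and output alphabet $C$).
   Context: Let $\mathcal{D}$ be a countably infinite set of data values with a distinguished $d_0\in\mathcal{D}$. For finite alphabets $\Sigma$ (input) and $\Gamma$ (output), a test over a finite register set $R$ is a Boolean combination of $\top,\bot,r^{=},r^{\neq}$ ($r\in R$); for $\tau:R\to\mathcal{D}$ and $d\in\mathcal{D}$, $\tau,d\models r^{=}$ iff $\tau(r)=d$, $\tau,d\models r^{\neq}$ iff $\tau(r)\neq d$. A non-deterministic register transducer (NRT) is $T=(Q,R,i_0,F,\Delta)$ with finite states $Q$, initial $i_0$, accepting $F\subseteq Q$, finite register set $R$, and finite $\Delta\subseteq Q\times\Sigma\times\mathrm{Tests}_R\times2^R\times(\Gamma\times R)^*\times Q$. From configuration $(q,\tau)$, reading $(\sigma,d)$, a transition $(q,\sigma,\phi,\mathrm{asgn},o,q')$ with $\tau,d\models\phi$ leads to $(q',\tau')$ with $\tau'(r)=d$ if $r\in\mathrm{asgn}$ and $\tau'(r)=\tau(r)$ otherwise, outputting $(\gamma_1,\tau'(r_1))\cdots(\gamma_m,\tau'(r_m))$ where $o=(\gamma_1,r_1)\cdots(\gamma_m,r_m)$. An accepting run starts in $i_0$ with all registers equal to $d_0$ and visits $F$ infinitely often; standing assumption: accepting runs produce infinite outputs. $[\![T]\!]\subseteq(\Sigma\times\mathcal{D})^\omega\times(\Gamma\times\mathcal{D})^\omega$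 is the set of pairs (input, output) of accepting runs; a function $f$ is defined by $T$ if $[\![T]\!]$ is (the graph of) the partial function $f$. -}

module Defs where

open import Data.Nat using (ℕ; zero; suc; _+_; _<_; _≤_)
open import Data.Fin using (Fin)
open import Data.Bool using (Bool; true; false)
open import Data.List using (List; length; lookup; map)
open import Data.List.Membership.Propositional using (_∈_)
open import Data.Product using (_×_; _,_; proj₁; proj₂; Σ; ∃; ∃-syntax)
open import Data.Sum using (_⊎_)
open import Data.Unit using (⊤)
open import Data.Empty using (⊥)
open import Relation.Nullary using (¬_)
open import Relation.Binary.PropositionalEquality using (_≡_; _≢_)

ωWord : Set → Set
ωWord A = ℕ → A

data Test (r : ℕ) : Set where
  tt ff : Test r
  eq neq : Fin r → Test r
  and or : Test r → Test r → Test r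
  not : Test r → Test r

module _ {D : Set} {r : ℕ} where
  _,_⊨_ : (Fin r → D) → D → Test r → Set
  τ , d ⊨ tt = ⊤
  τ , d ⊨ ff = ⊥
  τ , d ⊨ eq x = τ x ≡ d
  τ , d ⊨ neq x = τ x ≢ d
  τ , d ⊨ and φ ψ = (τ , d ⊨ φ) × (τ , d ⊨ ψ)
  τ , d ⊨ or φ ψ = (τ , d ⊨ φ) ⊎ (τ , d ⊨ ψ)
  τ , d ⊨ not φ = ¬ (τ , d ⊨ φ)

-- A transition (q, σ, φ, asgn, o, q'); input alphabet Fin nΣ, output alphabet Fin nΓ,
-- states Fin nQ, registers Fin nR; asgn ⊆ R given by its characteristic function.
record Transition (nΣ nΓ nQ nR : ℕ) : Set where
  field
    src  : Fin nQ
    lab  : Fin nΣ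
    test : Test nR
    asgn : Fin nR → Bool
    out  : List (Fin nΓ × Fin nR)
    tgt  : Fin nQ

record NRT (nΣ nΓ : ℕ) : Set where
  field
    nQ  : ℕ
    nR  : ℕ
    i₀  : Fin nQ
    F   : Fin nQ → Bool
    Δ   : List (Transition nΣ nΓ nQ nR)

update : {D : Set} {nR : ℕ} → (Fin nR → Bool) → (Fin nR → D) → D → Fin nR → D
update asgn τ d x with asgn x
... | true  = d
... | false = τ x

prefixLen : {A : Set} → (ℕ → List A) → ℕ → ℕ
prefixLen w zero = 0
prefixLen w (suc i) = prefixLen w i + length (w i)

IsConcat : {A : Set} → (ℕ → List A) → ωWord A → Set
IsConcat w y =
  (∀ i (j : Fin (length (w i))) → y (prefixLen w i + Data.Fin.toℕ j) ≡ lookup (w i) j)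
  × (∀ n → ∃[ i ] n < prefixLen w i)

module Semantics {D : Set} (d₀ : D) {nΣ nΓ : ℕ} (T : NRT nΣ nΓ) where
  open NRT T

  record Run (x : ωWord (Fin nΣ × D)) : Set where
    field
      state : ℕ → Fin nQ
      regs  : ℕ → Fin nR → D
      trans : ℕ → Transition nΣ nΓ nQ nR
      trans∈Δ : ∀ i → trans i ∈ Δ
      init-state : state 0 ≡ i₀
      init-regs  : ∀ x → regs 0 x ≡ d₀
      src-ok  : ∀ i → Transition.src (trans i) ≡ state i
      lab-ok  : ∀ i → Transition.lab (trans i) ≡ proj₁ (x i)
      test-ok : ∀ i → regs i , proj₂ (x i) ⊨ Transition.test (trans i)
      regs-ok : ∀ i r → regs (suc i) r ≡ update (Transition.asgn (trans i)) (regs i) (proj₂ (x i)) r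
      tgt-ok  : ∀ i → Transition.tgt (trans i) ≡ state (suc i)

    outAt : ℕ → List (Fin nΓ × D)
    outAt i = map (λ p → proj₁ p , regs (suc i) (proj₂ p)) (Transition.out (trans i))

    Accepting : Set
    Accepting = ∀ n → ∃[ m ] (n ≤ m × F (state m) ≡ true)

  open Run public

  ⟦_⟧ : ωWord (Fin nΣ × D) → ωWord (Fin nΓ × D) → Set
  ⟦_⟧ x y = Σ (Run x) λ ρ → Accepting ρ × IsConcat (outAt ρ) y

  InfiniteOutputs : Set
  InfiniteOutputs = ∀ x (ρ : Run x) → Accepting ρ → ∀ n → ∃[ i ] n < prefixLen (outAt ρ) i

  Functional : Set
  Functional = ∀ x y y' → ⟦_⟧ x y → ⟦_⟧ x y' → ∀ i → y i ≡ y' i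

open Semantics public using (InfiniteOutputs; Functional) renaming (⟦_⟧ to ⟦_⟧[_])

-- The composition runs g and f in lockstep: one transition simulates a transition of g and,
-- on the letters g outputs there, the corresponding transitions of f. Its control state holds
-- the states of g and f and a pointer from every register of g and f into its own
-- |Rg| + |Rf| + 1 registers, with the invariant that distinct referenced registers hold distinct
-- data. On reading a datum it guesses whether the datum is held by a referenced register or is
-- fresh (and then stored in an unreferenced one), so every test of g and f becomes a comparison of
-- pointers, checked in the finite control. Acceptance of both runs is a generalised Büchi condition,
-- reduced to a Büchi condition by a flag; and the output is f's output regrouped along g's output
-- blocks, which is infinite because f's is.

module Submission where

open import Defs
open import Data.Nat using (ℕ; zero; suc; _+_; _∸_; _<_; _≤_; z≤n; s≤s; _≤?_)
open import Data.Nat.Properties hiding (_≟_)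
import Data.Nat.Properties as ℕ
open import Data.Nat.ListAction using (sum)
open import Data.Fin as Fin using (Fin; toℕ; _↑ˡ_; _↑ʳ_)
open import Data.Fin.Properties using (_≟_; any?; pigeonhole; splitAt-↑ˡ; splitAt-↑ʳ) renaming (<⇒≢ to <⇒≢ᶠ)
open import Data.Bool using (Bool; true; false; _∧_; _∨_; if_then_else_) renaming (not to bnot)
open import Data.Bool.Properties using (∧-conicalˡ; ∧-conicalʳ; ∨-zeroʳ)
import Data.Bool.Properties as Bool
open import Data.List using (List; []; _∷_; length; lookup; map; _++_; zipWith; applyUpTo; cartesianProduct; allFin; filter)
open import Data.List.Properties using (length-++; length-map; map-++; map-cong; map-∘; length-applyUpTo)
open import Data.List.Membership.Propositional using (_∈_)
open import Data.List.Membership.Propositional.Properties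
  using (∈-map⁺; ∈-map⁻; ∈-filter⁺; ∈-filter⁻; ∈-cartesianProduct⁺; ∈-allFin; ∈-lookup)
open import Data.List.Relation.Unary.Any using (here; there; index)
open import Data.List.Relation.Unary.Any.Properties using (lookup-index)
open import Data.Maybe using (Maybe; just; nothing)
open import Data.Product using (Σ; _×_; _,_; proj₁; proj₂; ∃-syntax)
open import Data.Sum using (_⊎_; inj₁; inj₂; [_,_])
open import Data.Unit using (tt)
open import Data.Empty using (⊥-elim)
open import Data.Vec using (Vec; []; _∷_; tabulate; replicate)
import Data.Vec as Vec
open import Data.Vec.Properties using (lookup∘tabulate; lookup-replicate)
open import Function.Bundles using (_↔_; _⇔_; mk⇔)
open import Function.Properties.Inverse using (↔⇒↣)
open import Relation.Nullary using (¬_; Dec; does; proof; yes; no; contradiction)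
open import Relation.Nullary.Decidable using (_×-dec_; _⊎-dec_; ¬?; map′; decidable-stable)
open import Relation.Nullary.Reflects using (Reflects; ofʸ; ofⁿ; ¬-reflects; _×-reflects_; _⊎-reflects_)
open import Relation.Binary.Definitions using (DecidableEquality; tri<; tri≈; tri>)
open import Relation.Binary.PropositionalEquality hiding ([_])

private variable
  A B C : Set
  b : Bool

-- Words as concatenations of blocks

nth : List A → ℕ → Maybe A
nth []       n       = nothing
nth (x ∷ xs) zero    = just x
nth (x ∷ xs) (suc n) = nth xs n

nth-lookup : (xs : List A) (j : Fin (length xs)) → nth xs (toℕ j) ≡ just (lookup xs j)
nth-lookup (x ∷ xs) Fin.zero    = refl
nth-lookup (x ∷ xs) (Fin.suc j) = nth-lookup xs j

nth-++ˡ : (xs ys : List A) (j : ℕ) {a : A} → nth xs j ≡ just a → nth (xs ++ ys) j ≡ just a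
nth-++ˡ (x ∷ xs) ys zero    p = p
nth-++ˡ (x ∷ xs) ys (suc j) p = nth-++ˡ xs ys j p

nth-++ʳ : (xs ys : List A) (j : ℕ) → nth (xs ++ ys) (length xs + j) ≡ nth ys j
nth-++ʳ []       ys j = refl
nth-++ʳ (x ∷ xs) ys j = nth-++ʳ xs ys j

nth-++⁻ : (xs ys : List A) (j : ℕ) {a : A} → nth (xs ++ ys) j ≡ just a →
          nth xs j ≡ just a ⊎ ∃[ t ] (j ≡ length xs + t × nth ys t ≡ just a)
nth-++⁻ []       ys j       p = inj₂ (j , refl , p)
nth-++⁻ (x ∷ xs) ys zero    p = inj₁ p
nth-++⁻ (x ∷ xs) ys (suc j) p with nth-++⁻ xs ys j p
... | inj₁ q             = inj₁ q
... | inj₂ (t , e , q)   = inj₂ (t , cong suc e , q)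

nth-map : (f : A → B) (xs : List A) (j : ℕ) {a : A} → nth xs j ≡ just a → nth (map f xs) j ≡ just (f a)
nth-map f (x ∷ xs) zero    refl = refl
nth-map f (x ∷ xs) (suc j) p    = nth-map f xs j p

nth-map⁻ : (f : A → B) (xs : List A) (j : ℕ) {b : B} → nth (map f xs) j ≡ just b →
           ∃[ a ] (nth xs j ≡ just a × b ≡ f a)
nth-map⁻ f (x ∷ xs) zero    refl = x , refl , refl
nth-map⁻ f (x ∷ xs) (suc j) p    = nth-map⁻ f xs j p

nth-zipWith⁺ : (f : A → B → C) (l : List A) (m : List B) (j : ℕ) {a : A} {b : B} →
               nth l j ≡ just a → nth m j ≡ just b → nth (zipWith f l m) j ≡ just (f a b)
nth-zipWith⁺ f (x ∷ l) (y ∷ m) zero    refl refl = refl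
nth-zipWith⁺ f (x ∷ l) (y ∷ m) (suc j) e    e′   = nth-zipWith⁺ f l m j e e′

nth-zipWith⁻ : (f : A → B → C) (l : List A) (m : List B) (j : ℕ) {c : C} → nth (zipWith f l m) j ≡ just c →
               ∃[ a ] ∃[ b ] (nth l j ≡ just a × nth m j ≡ just b × c ≡ f a b)
nth-zipWith⁻ f (x ∷ l) (y ∷ m) zero    refl = x , y , refl , refl , refl
nth-zipWith⁻ f (x ∷ l) (y ∷ m) (suc j) e    = nth-zipWith⁻ f l m j e

nth⇒< : (xs : List A) (j : ℕ) {a : A} → nth xs j ≡ just a → j < length xs
nth⇒< (x ∷ xs) zero    p = s≤s z≤n
nth⇒< (x ∷ xs) (suc j) p = s≤s (nth⇒< xs j p)

<⇒nth : (xs : List A) (j : ℕ) → j < length xs → ∃[ a ] nth xs j ≡ just a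
<⇒nth (x ∷ xs) zero    p       = x , refl
<⇒nth (x ∷ xs) (suc j) (s≤s p) = <⇒nth xs j p

nth-applyUpTo : (f : ℕ → A) {n j : ℕ} → j < n → nth (applyUpTo f n) j ≡ just (f j)
nth-applyUpTo f {suc n} {zero}  _       = refl
nth-applyUpTo f {suc n} {suc j} (s≤s lt) = nth-applyUpTo (λ k → f (suc k)) lt

length-zipWith : (f : A → B → C) (l : List A) (m : List B) → length l ≡ length m → length (zipWith f l m) ≡ length m
length-zipWith f []      []      e = refl
length-zipWith f (x ∷ l) (y ∷ m) e = cong suc (length-zipWith f l m (suc-injective e))

∈⇒≤sum : {n : ℕ} {ns : List ℕ} → n ∈ ns → n ≤ sum ns
∈⇒≤sum {ns = n ∷ ns} (here refl) = m≤m+n n (sum ns)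
∈⇒≤sum {ns = m ∷ ns} (there n∈) = ≤-trans (∈⇒≤sum n∈) (m≤n+m (sum ns) m)

Unbounded : (ℕ → ℕ) → Set
Unbounded P = ∀ n → ∃[ i ] n < P i

IsConcatⁿ : (ℕ → List A) → ωWord A → Set
IsConcatⁿ w y = (∀ i j {a} → nth (w i) j ≡ just a → y (prefixLen w i + j) ≡ a) × Unbounded (prefixLen w)

private
  shift-agrees : (y : ωWord A) (base : ℕ) (xs : List A) →
                 (∀ (k : Fin (length xs)) → y (base + toℕ k) ≡ lookup xs k) →
                 ∀ j {a} → nth xs j ≡ just a → y (base + j) ≡ a
  shift-agrees y base (x ∷ xs) f zero    refl = f Fin.zero
  shift-agrees y base (x ∷ xs) f (suc j) p    =
    trans (cong y (+-suc base j))
      (shift-agrees y (suc base) xs (λ k → trans (cong y (sym (+-suc base (toℕ k)))) (f (Fin.suc k))) j p)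

IsConcat⇒IsConcatⁿ : {w : ℕ → List A} {y : ωWord A} → IsConcat w y → IsConcatⁿ w y
IsConcat⇒IsConcatⁿ {w = w} {y} (c , u) = (λ i → shift-agrees y (prefixLen w i) (w i) (c i)) , u

IsConcatⁿ⇒IsConcat : {w : ℕ → List A} {y : ωWord A} → IsConcatⁿ w y → IsConcat w y
IsConcatⁿ⇒IsConcat {w = w} (c , u) = (λ i j → c i (toℕ j) (nth-lookup (w i) j)) , u

prefixLen-cong : {w w' : ℕ → List A} → (∀ i → w i ≡ w' i) → ∀ i → prefixLen w i ≡ prefixLen w' i
prefixLen-cong e zero    = refl
prefixLen-cong e (suc i) = cong₂ _+_ (prefixLen-cong e i) (cong length (e i))

IsConcatⁿ-cong : {w w' : ℕ → List A} {z : ωWord A} → (∀ i → w i ≡ w' i) → IsConcatⁿ w z → IsConcatⁿ w' z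
IsConcatⁿ-cong {w = w} {w'} {z} e (c , u) =
  (λ i j p → subst (λ X → z (X + j) ≡ _) (prefixLen-cong e i) (c i j (subst (λ X → nth X j ≡ just _) (sym (e i)) p))) ,
  (λ n → let (i , lt) = u n in i , subst (n <_) (prefixLen-cong e i) lt)

prefixLen-mono : (w : ℕ → List A) {i i' : ℕ} → i ≤ i' → prefixLen w i ≤ prefixLen w i'
prefixLen-mono w {i} le with m≤n⇒∃[o]m+o≡n le
... | o , refl = go i o
  where
  go : ∀ i o → prefixLen w i ≤ prefixLen w (i + o)
  go i zero    rewrite +-identityʳ i = ≤-refl
  go i (suc o) rewrite +-suc i o     = ≤-trans (go i o) (m≤m+n _ (length (w (i + o))))

Block : (w : ℕ → List A) → ℕ → Set
Block w n = Σ ℕ λ i → prefixLen w i ≤ n × n < prefixLen w (suc i)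

block : (w : ℕ → List A) (n : ℕ) → ∃[ B ] n < prefixLen w B → Block w n
block w n (B , lt) = go B lt
  where
  go : ∀ B → n < prefixLen w B → Block w n
  go (suc B) lt with prefixLen w B ≤? n
  ... | yes le = B , le , lt
  ... | no nle = go B (≰⇒> nle)

block-unique : (w : ℕ → List A) {n i i' : ℕ} →
               prefixLen w i ≤ n → n < prefixLen w (suc i) →
               prefixLen w i' ≤ n → n < prefixLen w (suc i') → i ≡ i'
block-unique w {i = i} {i'} a b c d with <-cmp i i'
... | tri≈ _ e _  = e
... | tri< lt _ _ = ⊥-elim (<-irrefl refl (<-≤-trans b (≤-trans (prefixLen-mono w lt) c)))
... | tri> _ _ gt = ⊥-elim (<-irrefl refl (<-≤-trans d (≤-trans (prefixLen-mono w gt) a)))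

offset<length : (w : ℕ → List A) {n i : ℕ} → prefixLen w i ≤ n → n < prefixLen w (suc i) →
                n ∸ prefixLen w i < length (w i)
offset<length w {i = i} le lt =
  +-cancelˡ-< (prefixLen w i) _ _ (subst (_< prefixLen w i + length (w i)) (sym (m+[n∸m]≡n le)) lt)

flatten : (w : ℕ → List A) → Unbounded (prefixLen w) → ωWord A
flatten w u n with block w n (u n)
... | i , le , lt = proj₁ (<⇒nth (w i) (n ∸ prefixLen w i) (offset<length w le lt))

flatten-isConcat : (w : ℕ → List A) (u : Unbounded (prefixLen w)) → IsConcatⁿ w (flatten w u)
flatten-isConcat w u = agree , u
  where
  agree : ∀ i j {a} → nth (w i) j ≡ just a → flatten w u (prefixLen w i + j) ≡ a
  agree i j p with block w (prefixLen w i + j) (u (prefixLen w i + j))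
  ... | i' , le , lt with block-unique w le lt (m≤m+n (prefixLen w i) j) (+-monoʳ-< (prefixLen w i) (nth⇒< (w i) j p))
  ... | refl with <⇒nth (w i) (prefixLen w i + j ∸ prefixLen w i) (offset<length w le lt)
  ... | b , q rewrite m+n∸m≡n (prefixLen w i) j with trans (sym q) p
  ... | refl = refl

concatRange : (ℕ → List A) → ℕ → ℕ → List A
concatRange u a zero    = []
concatRange u a (suc k) = u a ++ concatRange u (suc a) k

prefixLen-concatRange : (u : ℕ → List A) (a k : ℕ) →
                        prefixLen u a + length (concatRange u a k) ≡ prefixLen u (a + k)
prefixLen-concatRange u a zero rewrite +-identityʳ a = +-identityʳ _
prefixLen-concatRange u a (suc k) rewrite length-++ (u a) {concatRange u (suc a) k} | +-suc a k =
  trans (sym (+-assoc (prefixLen u a) (length (u a)) _)) (prefixLen-concatRange u (suc a) k)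

regroup : (ℕ → List A) → (ℕ → List B) → ℕ → List A
regroup u v i = concatRange u (prefixLen v i) (length (v i))

prefixLen-regroup : (u : ℕ → List A) (v : ℕ → List B) (i : ℕ) →
                    prefixLen (regroup u v) i ≡ prefixLen u (prefixLen v i)
prefixLen-regroup u v zero    = refl
prefixLen-regroup u v (suc i) rewrite prefixLen-regroup u v i = prefixLen-concatRange u (prefixLen v i) (length (v i))

private
  concatRange-agrees : (u : ℕ → List A) (z : ωWord A) →
    (∀ a j {b} → nth (u a) j ≡ just b → z (prefixLen u a + j) ≡ b) →
    ∀ a k j {b} → nth (concatRange u a k) j ≡ just b → z (prefixLen u a + j) ≡ b
  concatRange-agrees u z h a (suc k) j p with nth-++⁻ (u a) (concatRange u (suc a) k) j p
  ... | inj₁ q             = h a j q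
  ... | inj₂ (t , refl , q) =
    trans (cong z (sym (+-assoc (prefixLen u a) (length (u a)) t))) (concatRange-agrees u z h (suc a) k t q)

  nth-concatRange : (u : ℕ → List A) → ∀ a t k j {b} → t < k → nth (u (a + t)) j ≡ just b →
    ∃[ j' ] (prefixLen u a + j' ≡ prefixLen u (a + t) + j × nth (concatRange u a k) j' ≡ just b)
  nth-concatRange u a zero (suc k) j lt p rewrite +-identityʳ a = j , refl , nth-++ˡ (u a) _ j p
  nth-concatRange u a (suc t) (suc k) j (s≤s lt) p rewrite +-suc a t with nth-concatRange u (suc a) t k j lt p
  ... | j' , e , q = length (u a) + j' , trans (sym (+-assoc (prefixLen u a) (length (u a)) j')) e ,
                     trans (nth-++ʳ (u a) _ j') q

regroup-isConcat⁺ : (u : ℕ → List A) (v : ℕ → List B) (z : ωWord A) → Unbounded (prefixLen v) →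
                    IsConcatⁿ u z → IsConcatⁿ (regroup u v) z
regroup-isConcat⁺ u v z uv (c , un) = agree , unbounded
  where
  agree : ∀ i j {a} → nth (regroup u v i) j ≡ just a → z (prefixLen (regroup u v) i + j) ≡ a
  agree i j p rewrite prefixLen-regroup u v i = concatRange-agrees u z c (prefixLen v i) (length (v i)) j p
  unbounded : Unbounded (prefixLen (regroup u v))
  unbounded n with un n
  ... | a , lt with uv a
  ... | i , lt2 = i , subst (n <_) (sym (prefixLen-regroup u v i)) (<-≤-trans lt (prefixLen-mono u (<⇒≤ lt2)))

regroup-isConcat⁻ : (u : ℕ → List A) (v : ℕ → List B) (z : ωWord A) → Unbounded (prefixLen v) →
                    IsConcatⁿ (regroup u v) z → IsConcatⁿ u z
regroup-isConcat⁻ u v z uv (c , un) = agree , unbounded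
  where
  agree : ∀ a j {b} → nth (u a) j ≡ just b → z (prefixLen u a + j) ≡ b
  agree a j {b} p with block v a (uv a)
  ... | i , le , lt with m≤n⇒∃[o]m+o≡n le
  ... | t , refl with nth-concatRange u (prefixLen v i) t (length (v i)) j
                        (+-cancelˡ-< (prefixLen v i) t (length (v i)) lt) p
  ... | j' , e , q = trans (cong z (sym e)) (subst (λ X → z (X + j') ≡ b) (prefixLen-regroup u v i) (c i j' q))
  unbounded : Unbounded (prefixLen u)
  unbounded n with un n
  ... | i , lt = prefixLen v i , subst (n <_) (prefixLen-regroup u v i) lt

-- Boolean reflection and tests

∨-true⁻ : ∀ a {b} → a ∨ b ≡ true → a ≡ true ⊎ b ≡ true
∨-true⁻ true  e = inj₁ refl
∨-true⁻ false e = inj₂ e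

∨-trueʳ : ∀ a {b} → b ≡ true → a ∨ b ≡ true
∨-trueʳ a e = trans (cong (a ∨_) e) (∨-zeroʳ a)

reflects-true : Reflects A b → b ≡ true → A
reflects-true (ofʸ a) refl = a

true-reflects : Reflects A b → A → b ≡ true
true-reflects (ofʸ _)  _ = refl
true-reflects (ofⁿ ¬a) a = contradiction a ¬a

reflects-map : (A → B) → (B → A) → Reflects A b → Reflects B b
reflects-map f g (ofʸ a)  = ofʸ (f a)
reflects-map f g (ofⁿ ¬a) = ofⁿ (λ b → ¬a (g b))

evalTest : {r : ℕ} → (Fin r → Bool) → Test r → Bool
evalTest at tt        = true
evalTest at ff        = false
evalTest at (eq x)    = at x
evalTest at (neq x)   = bnot (at x)
evalTest at (and φ ψ) = evalTest at φ ∧ evalTest at ψ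
evalTest at (or φ ψ)  = evalTest at φ ∨ evalTest at ψ
evalTest at (not φ)   = bnot (evalTest at φ)

evalTest-reflects : {D : Set} {r : ℕ} {τ : Fin r → D} {d : D} {at : Fin r → Bool} →
                    (∀ x → Reflects (τ x ≡ d) (at x)) → ∀ φ → Reflects (τ , d ⊨ φ) (evalTest at φ)
evalTest-reflects at tt        = ofʸ tt
evalTest-reflects at ff        = ofⁿ (λ ())
evalTest-reflects at (eq x)    = at x
evalTest-reflects at (neq x)   = ¬-reflects (at x)
evalTest-reflects at (and φ ψ) = evalTest-reflects at φ ×-reflects evalTest-reflects at ψ
evalTest-reflects at (or φ ψ)  = evalTest-reflects at φ ⊎-reflects evalTest-reflects at ψ
evalTest-reflects at (not φ)   = ¬-reflects (evalTest-reflects at φ)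

-- Enumerations

record Enumeration (A : Set) : Set where
  field
    elements : List A
    complete : ∀ a → a ∈ elements
open Enumeration public

module _ (E : Enumeration A) where

  size : ℕ
  size = length (elements E)

  encode : A → Fin size
  encode a = index (complete E a)

  decode : Fin size → A
  decode = lookup (elements E)

  decode-encode : ∀ a → decode (encode a) ≡ a
  decode-encode a = sym (lookup-index (complete E a))

  encode-injective : ∀ {a b} → encode a ≡ encode b → a ≡ b
  encode-injective {a} {b} e = trans (sym (decode-encode a)) (trans (cong decode e) (decode-encode b))

finEnumeration : ∀ n → Enumeration (Fin n)
finEnumeration n = record { elements = allFin n ; complete = ∈-allFin }

boolEnumeration : Enumeration Bool
boolEnumeration = record { elements = true ∷ false ∷ [] ; complete = λ { true → here refl ; false → there (here refl) } }

_×ₑ_ : Enumeration A → Enumeration B → Enumeration (A × B)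
EA ×ₑ EB = record
  { elements = cartesianProduct (elements EA) (elements EB)
  ; complete = λ (a , b) → ∈-cartesianProduct⁺ (complete EA a) (complete EB b) }

vecEnumeration : Enumeration A → ∀ n → Enumeration (Vec A n)
vecEnumeration {A} E n = record { elements = vecs n ; complete = vecs-complete n }
  where
  vecs : ∀ n → List (Vec A n)
  vecs zero    = [] ∷ []
  vecs (suc n) = map (λ (x , v) → x ∷ v) (cartesianProduct (elements E) (vecs n))

  vecs-complete : ∀ n (v : Vec A n) → v ∈ vecs n
  vecs-complete zero    []      = here refl
  vecs-complete (suc n) (x ∷ v) =
    ∈-map⁺ (λ (x , v) → x ∷ v) (∈-cartesianProduct⁺ (complete E x) (vecs-complete n v))

retractEnumeration : Enumeration A → (f : A → B) (g : B → A) → (∀ b → f (g b) ≡ b) → Enumeration B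
retractEnumeration E f g fg = record
  { elements = map f (elements E)
  ; complete = λ b → subst (_∈ map f (elements E)) (fg b) (∈-map⁺ f (complete E (g b))) }

listsUpTo : List A → ℕ → List (List A)
listsUpTo xs zero    = [] ∷ []
listsUpTo xs (suc n) = [] ∷ map (λ (x , l) → x ∷ l) (cartesianProduct xs (listsUpTo xs n))

listsUpTo-complete : (E : Enumeration A) → ∀ n (l : List A) → length l ≤ n → l ∈ listsUpTo (elements E) n
listsUpTo-complete E zero    []      _       = here refl
listsUpTo-complete E (suc n) []      _       = here refl
listsUpTo-complete E (suc n) (x ∷ l) (s≤s le) =
  there (∈-map⁺ (λ (x , l) → x ∷ l) (∈-cartesianProduct⁺ (complete E x) (listsUpTo-complete E n l le)))

-- Büchi conditions

InfinitelyOften : (ℕ → Bool) → Set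
InfinitelyOften P = ∀ n → ∃[ m ] (n ≤ m × P m ≡ true)

-- The reduction of the generalised Büchi condition "G and V infinitely often" to a Büchi
-- condition: Fl i records whether V has held since the last position at which G held.
module Flag (G V Fl : ℕ → Bool) (Fl-suc : ∀ i → Fl (suc i) ≡ (V i ∨ (Fl i ∧ bnot (G i)))) where

  flag⇒visited : ∀ m → Fl m ≡ true → ∀ m₁ → m₁ < m → G m₁ ≡ true → ∃[ j ] (m₁ ≤ j × V j ≡ true)
  flag⇒visited (suc m) e m₁ lt g with V m in ev
  ... | true  = m , ≤-pred lt , ev
  ... | false = carried (Fl m) (G m) refl refl (trans (sym (trans (Fl-suc m) (cong (_∨ (Fl m ∧ bnot (G m))) ev))) e)
    where
    carried : ∀ f h → Fl m ≡ f → G m ≡ h → (false ∨ (f ∧ bnot h)) ≡ true → ∃[ j ] (m₁ ≤ j × V j ≡ true)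
    carried true false ef eg _ with m≤n⇒m<n∨m≡n (≤-pred lt)
    ... | inj₁ lt′  = flag⇒visited m ef m₁ lt′ g
    ... | inj₂ refl with trans (sym g) eg
    ...   | ()

  flag-persists : ∀ m → Fl m ≡ true → ∀ k → Fl (m + k) ≡ true ⊎ ∃[ j ] (m ≤ j × (Fl j ∧ G j) ≡ true)
  flag-persists m e zero rewrite +-identityʳ m = inj₁ e
  flag-persists m e (suc k) with flag-persists m e k
  ... | inj₂ found = inj₂ found
  ... | inj₁ e′ with G (m + k) in eg
  ... | true  = inj₂ (m + k , m≤m+n m k , cong₂ _∧_ e′ eg)
  ... | false rewrite +-suc m k | Fl-suc (m + k) | e′ | eg with V (m + k)
  ...   | true  = inj₁ refl
  ...   | false = inj₁ refl

  often-flag⇒often-both : InfinitelyOften (λ m → Fl m ∧ G m) → InfinitelyOften G × InfinitelyOften V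
  often-flag⇒often-both often = often-G , often-V
    where
    often-G : InfinitelyOften G
    often-G n = let (m , le , e) = often n in m , le , ∧-conicalʳ (Fl m) _ e
    often-V : InfinitelyOften V
    often-V n =
      let (m₁ , le₁ , e₁) = often n
          (m₂ , le₂ , e₂) = often (suc m₁)
          (j  , le₃ , e₃) = flag⇒visited m₂ (∧-conicalˡ _ _ e₂) m₁ le₂ (∧-conicalʳ (Fl m₁) _ e₁)
      in j , ≤-trans le₁ le₃ , e₃

  often-both⇒often-flag : InfinitelyOften G → InfinitelyOften V → InfinitelyOften (λ m → Fl m ∧ G m)
  often-both⇒often-flag often-G often-V n with often-V n
  ... | j , le , ev with often-G (suc j)
  ... | m , le₂ , eg with m≤n⇒∃[o]m+o≡n le₂
  ... | k , refl with flag-persists (suc j) (trans (Fl-suc j) (cong (_∨ _) ev)) k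
  ... | inj₁ ef = suc j + k , ≤-trans le (≤-trans (n≤1+n j) (m≤m+n (suc j) k)) , cong₂ _∧_ ef eg
  ... | inj₂ (j′ , le₃ , e) = j′ , ≤-trans le (≤-trans (n≤1+n j) le₃) , e

-- The composed transducer

module Composition {nA nB nC : ℕ} (Tg : NRT nA nB) (Tf : NRT nB nC) where
  module G = NRT Tg
  module H = NRT Tf
  module Tr = Transition

  -- Every register of g and of f points to a register of the composition; one more register
  -- than there are pointers guarantees a free one.
  K : ℕ
  K = suc (G.nR + H.nR)

  _==_ : Fin K → Fin K → Bool
  a == b = does (a ≟ b)

  repoint : {n : ℕ} → (Fin n → Bool) → Vec (Fin K) n → Fin K → Vec (Fin K) n
  repoint asgn v c = tabulate (λ r → if asgn r then c else Vec.lookup v r)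

  gtr : Fin (length G.Δ) → Transition nA nB G.nQ G.nR
  gtr = lookup G.Δ

  ftr : Fin (length H.Δ) → Transition nB nC H.nQ H.nR
  ftr = lookup H.Δ

  record State : Set where
    constructor state
    field
      qg   : Fin G.nQ
      qf   : Fin H.nQ
      pg   : Vec (Fin K) G.nR
      pf   : Vec (Fin K) H.nR
      flag : Bool
  open State public

  stateEnumeration : Enumeration State
  stateEnumeration = retractEnumeration
    (finEnumeration G.nQ ×ₑ (finEnumeration H.nQ ×ₑ (vecEnumeration (finEnumeration K) G.nR
      ×ₑ (vecEnumeration (finEnumeration K) H.nR ×ₑ boolEnumeration))))
    (λ (a , b , c , d , e) → state a b c d e) (λ s → qg s , qf s , pg s , pf s , flag s) (λ s → refl)

  Ref : State → Fin K → Set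
  Ref st a = (∃[ r ] Vec.lookup (pg st) r ≡ a) ⊎ (∃[ r ] Vec.lookup (pf st) r ≡ a)

  Ref? : ∀ st a → Dec (Ref st a)
  Ref? st a = any? (λ r → Vec.lookup (pg st) r ≟ a) ⊎-dec any? (λ r → Vec.lookup (pf st) r ≟ a)

  -- The datum just read is either held in the referenced register k (seen = true),
  -- or it is fresh and gets stored in the unreferenced register k.
  SlotOk : State → Bool → Fin K → Set
  SlotOk st true  k = Ref st k
  SlotOk st false k = ¬ Ref st k

  slotOk? : ∀ st seen k → Dec (SlotOk st seen k)
  slotOk? st true  k = Ref? st k
  slotOk? st false k = ¬? (Ref? st k)

  allDistinct : {m : ℕ} → Vec (Fin K) m → Test K
  allDistinct Vec.[]       = Test.tt
  allDistinct (x Vec.∷ xs) = Test.and (Test.neq x) (allDistinct xs)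

  slotTest : State → Bool → Fin K → Test K
  slotTest st true  k = Test.eq k
  slotTest st false k = Test.and (allDistinct (pg st)) (allDistinct (pf st))

  slotAsgn : Bool → Fin K → Fin K → Bool
  slotAsgn seen k a = bnot seen ∧ (a == k)

  -- visited records whether f has entered an accepting state during the current step.
  record FConf : Set where
    constructor fconf
    field
      q       : Fin H.nQ
      p       : Vec (Fin K) H.nR
      visited : Bool
  open FConf public

  -- ptr points to the register holding the datum of the letter γ read by transition δ.
  record FMove : Set where
    constructor fmove
    field
      δ   : Fin (length H.Δ)
      γ   : Fin nB
      ptr : Fin K
  open FMove public

  fstep : FConf → FMove → FConf
  fstep c m = fconf (Tr.tgt (ftr (δ m))) (repoint (Tr.asgn (ftr (δ m))) (p c) (ptr m))
                    (visited c ∨ H.F (Tr.tgt (ftr (δ m))))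

  record FStepOk (c : FConf) (m : FMove) : Set where
    field
      src  : Tr.src (ftr (δ m)) ≡ q c
      lab  : Tr.lab (ftr (δ m)) ≡ γ m
      test : evalTest (λ s → Vec.lookup (p c) s == ptr m) (Tr.test (ftr (δ m))) ≡ true

  fStepOk? : ∀ c m → Dec (FStepOk c m)
  fStepOk? c m = map′ (λ (a , b , e) → record { src = a ; lab = b ; test = e })
                      (λ o → FStepOk.src o , FStepOk.lab o , FStepOk.test o)
                      (Tr.src (ftr (δ m)) ≟ q c ×-dec Tr.lab (ftr (δ m)) ≟ γ m ×-dec
                       evalTest (λ s → Vec.lookup (p c) s == ptr m) (Tr.test (ftr (δ m))) Bool.≟ true)

  data FRun : FConf → List FMove → Set where
    []  : ∀ {c} → FRun c []
    _∷_ : ∀ {c m ms} → FStepOk c m → FRun (fstep c m) ms → FRun c (m ∷ ms)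

  fRun? : ∀ c ms → Dec (FRun c ms)
  fRun? c []       = yes []
  fRun? c (m ∷ ms) with fStepOk? c m | fRun? (fstep c m) ms
  ... | yes o | yes r = yes (o ∷ r)
  ... | no ¬o | _     = no λ { (o ∷ _) → ¬o o }
  ... | yes _ | no ¬r = no λ { (_ ∷ r) → ¬r r }

  fconfAt : FConf → List FMove → ℕ → FConf
  fconfAt c ms       zero    = c
  fconfAt c []       (suc j) = c
  fconfAt c (m ∷ ms) (suc j) = fconfAt (fstep c m) ms j

  moveOutput : FConf → FMove → List (Fin nC × Fin K)
  moveOutput c m = map (λ (γ′ , s) → γ′ , Vec.lookup (p (fstep c m)) s) (Tr.out (ftr (δ m)))

  fOutput : FConf → List FMove → List (Fin nC × Fin K)
  fOutput c []       = []
  fOutput c (m ∷ ms) = moveOutput c m ++ fOutput (fstep c m) ms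

  fStart : State → FConf
  fStart st = fconf (qf st) (pf st) false

  -- A transition of the composition simulates one transition of g, chosen together with
  -- the transitions f takes on the letters g outputs.
  record Choice : Set where
    constructor choice
    field
      from : State
      gδ   : Fin (length G.Δ)
      seen : Bool
      slot : Fin K
      fδs  : List (Fin (length H.Δ))
  open Choice public

  gPtrs′ : Choice → Vec (Fin K) G.nR
  gPtrs′ π = repoint (Tr.asgn (gtr (gδ π))) (pg (from π)) (slot π)

  gOut : Choice → List (Fin nB × Fin K)
  gOut π = map (λ (γ , r) → γ , Vec.lookup (gPtrs′ π) r) (Tr.out (gtr (gδ π)))

  fMoves : Choice → List FMove
  fMoves π = zipWith (λ d (γ , c) → fmove d γ c) (fδs π) (gOut π)

  fEnd : Choice → FConf
  fEnd π = fconfAt (fStart (from π)) (fMoves π) (length (fMoves π))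

  record Valid (π : Choice) : Set where
    field
      src    : Tr.src (gtr (gδ π)) ≡ qg (from π)
      test   : evalTest (λ r → Vec.lookup (pg (from π)) r == slot π) (Tr.test (gtr (gδ π))) ≡ true
      slotOk : SlotOk (from π) (seen π) (slot π)
      lengths : length (fδs π) ≡ length (gOut π)
      fRun   : FRun (fStart (from π)) (fMoves π)

  valid? : ∀ π → Dec (Valid π)
  valid? π = map′ (λ (a , b , c , d , e) → record { src = a ; test = b ; slotOk = c ; lengths = d ; fRun = e })
                  (λ v → Valid.src v , Valid.test v , Valid.slotOk v , Valid.lengths v , Valid.fRun v)
                  (Tr.src (gtr (gδ π)) ≟ qg (from π) ×-dec
                   evalTest (λ r → Vec.lookup (pg (from π)) r == slot π) (Tr.test (gtr (gδ π))) Bool.≟ true ×-dec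
                   slotOk? (from π) (seen π) (slot π) ×-dec
                   length (fδs π) ℕ.≟ length (gOut π) ×-dec
                   fRun? (fStart (from π)) (fMoves π))

  target : Choice → State
  target π = state (Tr.tgt (gtr (gδ π))) (q (fEnd π)) (gPtrs′ π) (p (fEnd π))
                   (visited (fEnd π) ∨ (flag (from π) ∧ bnot (G.F (qg (from π)))))

  transition : Choice → Transition nA nC (size stateEnumeration) K
  transition π = record
    { src  = encode stateEnumeration (from π)
    ; lab  = Tr.lab (gtr (gδ π))
    ; test = slotTest (from π) (seen π) (slot π)
    ; asgn = slotAsgn (seen π) (slot π)
    ; out  = fOutput (fStart (from π)) (fMoves π)
    ; tgt  = encode stateEnumeration (target π) }

  maxOut : ℕ
  maxOut = sum (map (λ tr → length (Tr.out tr)) G.Δ)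

  choices : List Choice
  choices = map (λ (a , b , c , d , e) → choice a b c d e)
    (cartesianProduct (elements stateEnumeration) (cartesianProduct (allFin _) (cartesianProduct (elements boolEnumeration)
      (cartesianProduct (allFin K) (listsUpTo (allFin _) maxOut)))))

  start : State
  start = state G.i₀ H.i₀ (replicate G.nR Fin.zero) (replicate H.nR Fin.zero) false

  composition : NRT nA nC
  composition = record
    { nQ = size stateEnumeration
    ; nR = K
    ; i₀ = encode stateEnumeration start
    ; F  = λ c → let st = decode stateEnumeration c in flag st ∧ G.F (qg st)
    ; Δ  = map transition (filter valid? choices) }

module CompositionProperties {nA nB nC : ℕ} (Tg : NRT nA nB) (Tf : NRT nB nC) where
  open Composition Tg Tf

  ==-reflects : (a b : Fin K) → Reflects (a ≡ b) (a == b)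
  ==-reflects a b = proof (a ≟ b)

  ==-refl : (a : Fin K) → a == a ≡ true
  ==-refl a = true-reflects (==-reflects a a) refl

  lookup-repoint : {n : ℕ} (asgn : Fin n → Bool) (v : Vec.Vec (Fin K) n) (c : Fin K) (r : Fin n) →
                   Vec.lookup (repoint asgn v c) r ≡ (if asgn r then c else Vec.lookup v r)
  lookup-repoint asgn v c r = lookup∘tabulate (λ r → if asgn r then c else Vec.lookup v r) r

  fconfAt-suc : ∀ c ms j m → nth ms j ≡ just m → fconfAt c ms (suc j) ≡ fstep (fconfAt c ms j) m
  fconfAt-suc c (m ∷ ms) zero    m refl = refl
  fconfAt-suc c (_ ∷ ms) (suc j) m e    = fconfAt-suc _ ms j m e

  FRun⇒FStepOk : ∀ {c ms} → FRun c ms → ∀ j m → nth ms j ≡ just m → FStepOk (fconfAt c ms j) m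
  FRun⇒FStepOk (o ∷ r) zero    m refl = o
  FRun⇒FStepOk (o ∷ r) (suc j) m e    = FRun⇒FStepOk r j m e

  FStepOk⇒FRun : ∀ c ms → (∀ j m → nth ms j ≡ just m → FStepOk (fconfAt c ms j) m) → FRun c ms
  FStepOk⇒FRun c []       ok = []
  FStepOk⇒FRun c (m ∷ ms) ok = ok zero m refl ∷ FStepOk⇒FRun (fstep c m) ms (λ j → ok (suc j))

  map-fOutput : {A : Set} (val : Fin nC × Fin K → A) (U : ℕ → List A) → ∀ c ms a →
                (∀ j m → nth ms j ≡ just m → map val (moveOutput (fconfAt c ms j) m) ≡ U (a + j)) →
                map val (fOutput c ms) ≡ concatRange U a (length ms)
  map-fOutput val U c []       a hyp = refl
  map-fOutput val U c (m ∷ ms) a hyp =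
    trans (map-++ val (moveOutput c m) (fOutput (fstep c m) ms))
      (cong₂ _++_ (trans (hyp zero m refl) (cong U (+-identityʳ a)))
        (map-fOutput val U (fstep c m) ms (suc a) (λ j m e → trans (hyp (suc j) m e) (cong U (+-suc a j)))))

  visited-mono : ∀ c ms j → visited c ≡ true → visited (fconfAt c ms j) ≡ true
  visited-mono c ms       zero    e = e
  visited-mono c []       (suc j) e = e
  visited-mono c (m ∷ ms) (suc j) e = visited-mono (fstep c m) ms j (cong (_∨ _) e)

  visited⇒accepting : ∀ c ms j → visited (fconfAt c ms j) ≡ true →
    visited c ≡ true ⊎ ∃[ j′ ] (j′ < length ms × H.F (q (fconfAt c ms (suc j′))) ≡ true)
  visited⇒accepting c ms       zero    e = inj₁ e
  visited⇒accepting c []       (suc j) e = inj₁ e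
  visited⇒accepting c (m ∷ ms) (suc j) e with visited⇒accepting (fstep c m) ms j e
  ... | inj₂ (j′ , lt , f) = inj₂ (suc j′ , s≤s lt , f)
  ... | inj₁ e′ with ∨-true⁻ (visited c) e′
  ...   | inj₁ e″ = inj₁ e″
  ...   | inj₂ e″ = inj₂ (zero , s≤s z≤n , e″)

  accepting⇒visited : ∀ c ms j′ → j′ < length ms → H.F (q (fconfAt c ms (suc j′))) ≡ true →
                      visited (fconfAt c ms (length ms)) ≡ true
  accepting⇒visited c (m ∷ ms) zero     lt       e = visited-mono (fstep c m) ms (length ms) (∨-trueʳ (visited c) e)
  accepting⇒visited c (m ∷ ms) (suc j′) (s≤s lt) e = accepting⇒visited (fstep c m) ms j′ lt e

  if-elim : {A : Set} (P : A → Set) (b : Bool) {a a′ : A} → P a → P a′ → P (if b then a else a′)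
  if-elim P true  pa pa′ = pa
  if-elim P false pa pa′ = pa′

  fconfAt-ptrs : (P : Fin K → Set) → ∀ c ms → (∀ s → P (Vec.lookup (p c) s)) →
                 (∀ j m → nth ms j ≡ just m → P (ptr m)) → ∀ j s → P (Vec.lookup (p (fconfAt c ms j)) s)
  fconfAt-ptrs P c ms       hc hm zero    s = hc s
  fconfAt-ptrs P c []       hc hm (suc j) s = hc s
  fconfAt-ptrs P c (m ∷ ms) hc hm (suc j) s =
    fconfAt-ptrs P (fstep c m) ms
      (λ s′ → subst P (sym (lookup-repoint (Transition.asgn (ftr (δ m))) (p c) (ptr m) s′))
                (if-elim P (Transition.asgn (ftr (δ m)) s′) (hm zero m refl) (hc s′)))
      (λ j → hm (suc j)) j s

  Ref⁺ : Choice → Fin K → Set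
  Ref⁺ π a = Ref (from π) a ⊎ a ≡ slot π

  gPtrs′-Ref⁺ : ∀ π r → Ref⁺ π (Vec.lookup (gPtrs′ π) r)
  gPtrs′-Ref⁺ π r rewrite lookup-repoint (Transition.asgn (gtr (gδ π))) (pg (from π)) (slot π) r
    with Transition.asgn (gtr (gδ π)) r
  ... | true  = inj₂ refl
  ... | false = inj₁ (inj₁ (r , refl))

  nth-fMoves⁻ : ∀ π j {m} → nth (fMoves π) j ≡ just m →
    nth (fδs π) j ≡ just (δ m) ×
    ∃[ r ] (nth (Transition.out (gtr (gδ π))) j ≡ just (γ m , r) × ptr m ≡ Vec.lookup (gPtrs′ π) r)
  nth-fMoves⁻ π j e with nth-zipWith⁻ _ (fδs π) (gOut π) j e
  ... | d , (γ , c) , e₁ , e₂ , refl with nth-map⁻ _ (Transition.out (gtr (gδ π))) j e₂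
  ...   | (γ′ , r) , e₃ , refl = e₁ , r , e₃ , refl

  fMoves-Ref⁺ : ∀ π j m → nth (fMoves π) j ≡ just m → Ref⁺ π (ptr m)
  fMoves-Ref⁺ π j m e with nth-fMoves⁻ π j e
  ... | _ , r , _ , e′ = subst (Ref⁺ π) (sym e′) (gPtrs′-Ref⁺ π r)

  fconfAt-Ref⁺ : ∀ π j s → Ref⁺ π (Vec.lookup (p (fconfAt (fStart (from π)) (fMoves π) j)) s)
  fconfAt-Ref⁺ π = fconfAt-ptrs (Ref⁺ π) (fStart (from π)) (fMoves π) (λ s → inj₁ (inj₂ (s , refl))) (fMoves-Ref⁺ π)

  Ref-target : ∀ π a → Ref (target π) a → Ref⁺ π a
  Ref-target π a (inj₁ (r , refl)) = gPtrs′-Ref⁺ π r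
  Ref-target π a (inj₂ (r , refl)) = fconfAt-Ref⁺ π (length (fMoves π)) r

  Ref-start : ∀ a → Ref start a → a ≡ Fin.zero
  Ref-start a (inj₁ (r , refl)) = lookup-replicate r Fin.zero
  Ref-start a (inj₂ (r , refl)) = lookup-replicate r Fin.zero

  -- Pigeonhole: the K registers cannot all be referenced by the G.nR + H.nR pointers.
  freeSlot : ∀ st → ∃[ a ] ¬ Ref st a
  freeSlot st with any? (λ a → ¬? (Ref? st a))
  ... | yes found = found
  ... | no none   = ⊥-elim (<⇒≢ᶠ i<j (trans (sym (decode-code i)) (trans (cong decodePtr ci≡cj) (decode-code j))))
    where
    referenced : ∀ a → Ref st a
    referenced a = decidable-stable (Ref? st a) (λ ¬r → none (a , ¬r))
    code : Fin K → Fin (G.nR + H.nR)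
    code a = [ (λ (r , _) → r ↑ˡ H.nR) , (λ (r , _) → G.nR ↑ʳ r) ] (referenced a)
    decodePtr : Fin (G.nR + H.nR) → Fin K
    decodePtr c = [ Vec.lookup (pg st) , Vec.lookup (pf st) ] (Fin.splitAt G.nR c)
    decode-code : ∀ a → decodePtr (code a) ≡ a
    decode-code a with referenced a
    ... | inj₁ (r , e) rewrite splitAt-↑ˡ G.nR r H.nR = e
    ... | inj₂ (r , e) rewrite splitAt-↑ʳ G.nR H.nR r = e
    collision = pigeonhole (n<1+n (G.nR + H.nR)) code
    i = proj₁ collision
    j = proj₁ (proj₂ collision)
    i<j = proj₁ (proj₂ (proj₂ collision))
    ci≡cj = proj₂ (proj₂ (proj₂ collision))

update-if : {D : Set} {n : ℕ} (asgn : Fin n → Bool) (τ : Fin n → D) (d : D) (r : Fin n) →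
            update asgn τ d r ≡ (if asgn r then d else τ r)
update-if asgn τ d r with asgn r
... | true  = refl
... | false = refl

module RegisterInvariant {D : Set} {nA nB nC : ℕ} (Tg : NRT nA nB) (Tf : NRT nB nC) where
  open Composition Tg Tf
  open CompositionProperties Tg Tf

  Distinct : State → (Fin K → D) → Set
  Distinct st τ = ∀ a a′ → Ref st a → Ref st a′ → τ a ≡ τ a′ → a ≡ a′

  allDistinct-sound : ∀ {m} (τ : Fin K → D) d (v : Vec (Fin K) m) → τ , d ⊨ allDistinct v → ∀ r → τ (Vec.lookup v r) ≢ d
  allDistinct-sound τ d (x ∷ v) (ne , _)  Fin.zero    = ne
  allDistinct-sound τ d (x ∷ v) (_ , nes) (Fin.suc r) = allDistinct-sound τ d v nes r

  allDistinct-complete : ∀ {m} (τ : Fin K → D) d (v : Vec (Fin K) m) → (∀ r → τ (Vec.lookup v r) ≢ d) → τ , d ⊨ allDistinct v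
  allDistinct-complete τ d []      ne = tt
  allDistinct-complete τ d (x ∷ v) ne = ne Fin.zero , allDistinct-complete τ d v (λ r → ne (Fin.suc r))

  freshTest-sound : ∀ st (τ : Fin K → D) d k → τ , d ⊨ slotTest st false k → ∀ a → Ref st a → τ a ≢ d
  freshTest-sound st τ d k (ne , _) a (inj₁ (r , refl)) = allDistinct-sound τ d (pg st) ne r
  freshTest-sound st τ d k (_ , ne) a (inj₂ (r , refl)) = allDistinct-sound τ d (pf st) ne r

  freshTest-complete : ∀ st (τ : Fin K → D) d k → (∀ a → Ref st a → τ a ≢ d) → τ , d ⊨ slotTest st false k
  freshTest-complete st τ d k fresh = allDistinct-complete τ d (pg st) (λ r → fresh _ (inj₁ (r , refl))) ,
                                      allDistinct-complete τ d (pf st) (λ r → fresh _ (inj₂ (r , refl)))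

  module SlotStep (st : State) (τ : Fin K → D) (d : D) (seen : Bool) (k : Fin K) (distinct : Distinct st τ)
                  (ok : SlotOk st seen k) (sat : τ , d ⊨ slotTest st seen k) where

    τ′ : Fin K → D
    τ′ = update (slotAsgn seen k) τ d

    holds⇒slot : ∀ a → Ref st a → τ a ≡ d → a ≡ k
    holds⇒slot = go seen ok sat
      where
      go : ∀ seen → SlotOk st seen k → τ , d ⊨ slotTest st seen k → ∀ a → Ref st a → τ a ≡ d → a ≡ k
      go true  ok sat a ra e = distinct a k ra ok (trans e (sym sat))
      go false ok sat a ra e = contradiction e (freshTest-sound st τ d k sat a ra)

    slot⇒holds : ∀ a → Ref st a → a ≡ k → τ a ≡ d
    slot⇒holds = go seen ok sat
      where
      go : ∀ seen → SlotOk st seen k → τ , d ⊨ slotTest st seen k → ∀ a → Ref st a → a ≡ k → τ a ≡ d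
      go true  ok  sat a ra refl = sat
      go false ¬ra sat a ra refl = contradiction ra ¬ra

    holds-reflects : ∀ a → Ref st a → Reflects (τ a ≡ d) (a == k)
    holds-reflects a ra = reflects-map (slot⇒holds a ra) (holds⇒slot a ra) (==-reflects a k)

    τ′-slot : τ′ k ≡ d
    τ′-slot = go seen sat
      where
      go : ∀ seen → τ , d ⊨ slotTest st seen k → update (slotAsgn seen k) τ d k ≡ d
      go true  sat = sat
      go false sat rewrite ==-refl k = refl

    τ′-Ref : ∀ a → Ref st a → τ′ a ≡ τ a
    τ′-Ref = go seen ok
      where
      go : ∀ seen → SlotOk st seen k → ∀ a → Ref st a → update (slotAsgn seen k) τ d a ≡ τ a
      go true  ok  a ra = refl
      go false ¬rk a ra with a ≟ k
      ... | yes refl = contradiction ra ¬rk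
      ... | no _     = refl

    distinct′ : ∀ a a′ → Ref st a ⊎ a ≡ k → Ref st a′ ⊎ a′ ≡ k → τ′ a ≡ τ′ a′ → a ≡ a′
    distinct′ a a′ (inj₁ ra) (inj₁ ra′) e = distinct a a′ ra ra′ (trans (sym (τ′-Ref a ra)) (trans e (τ′-Ref a′ ra′)))
    distinct′ a a′ (inj₁ ra) (inj₂ refl) e = holds⇒slot a ra (trans (sym (τ′-Ref a ra)) (trans e τ′-slot))
    distinct′ a a′ (inj₂ refl) (inj₁ ra′) e = sym (holds⇒slot a′ ra′ (trans (sym (τ′-Ref a′ ra′)) (trans (sym e) τ′-slot)))
    distinct′ a a′ (inj₂ refl) (inj₂ refl) e = refl

-- Soundness

module Soundness {D : Set} (d₀ : D) {nA nB nC : ℕ} (Tg : NRT nA nB) (Tf : NRT nB nC)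
                 (infG : InfiniteOutputs d₀ Tg) where
  open Composition Tg Tf
  open CompositionProperties Tg Tf
  open RegisterInvariant {D} Tg Tf
  module T = Semantics d₀ composition
  module g = Semantics d₀ Tg
  module f = Semantics d₀ Tf

  module _ (x : ωWord (Fin nA × D)) (ρ : T.Run x) (acc : T.Accepting ρ) where

    opaque
      chosen : ∀ i → ∃[ π ] ((π ∈ filter valid? choices) × T.trans ρ i ≡ transition π)
      chosen i = ∈-map⁻ transition (T.trans∈Δ ρ i)

    π : ℕ → Choice
    π i = proj₁ (chosen i)

    valid : ∀ i → Valid (π i)
    valid i = proj₂ (∈-filter⁻ valid? {xs = choices} (proj₁ (proj₂ (chosen i))))

    trans≡ : ∀ i → T.trans ρ i ≡ transition (π i)
    trans≡ i = proj₂ (proj₂ (chosen i))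

    st : ℕ → State
    st i = from (π i)

    τ : ℕ → Fin K → D
    τ = T.regs ρ

    datum : ℕ → D
    datum i = proj₂ (x i)

    st-zero : st 0 ≡ start
    st-zero = encode-injective stateEnumeration (trans (trans (cong Tr.src (sym (trans≡ 0))) (T.src-ok ρ 0)) (T.init-state ρ))

    target≡ : ∀ i → target (π i) ≡ st (suc i)
    target≡ i = encode-injective stateEnumeration
      (trans (cong Tr.tgt (sym (trans≡ i))) (trans (T.tgt-ok ρ i) (trans (sym (T.src-ok ρ (suc i))) (cong Tr.src (trans≡ (suc i))))))

    sat : ∀ i → τ i , datum i ⊨ slotTest (st i) (seen (π i)) (slot (π i))
    sat i = subst (λ tr → τ i , datum i ⊨ Tr.test tr) (trans≡ i) (T.test-ok ρ i)

    τ-suc : ∀ i a → τ (suc i) a ≡ update (slotAsgn (seen (π i)) (slot (π i))) (τ i) (datum i) a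
    τ-suc i a = trans (T.regs-ok ρ i a) (cong (λ tr → update (Tr.asgn tr) (τ i) (datum i) a) (trans≡ i))

    distinct : ∀ i → Distinct (st i) (τ i)

    module Step (i : ℕ) = SlotStep (st i) (τ i) (datum i) (seen (π i)) (slot (π i)) (distinct i) (Valid.slotOk (valid i)) (sat i)

    distinct zero = subst (λ s → Distinct s (τ 0)) (sym st-zero)
      (λ a a′ ra ra′ _ → trans (Ref-start a ra) (sym (Ref-start a′ ra′)))
    distinct (suc i) = subst (λ s → Distinct s (τ (suc i))) (target≡ i)
      (λ a a′ ra ra′ e → Step.distinct′ i a a′ (Ref-target (π i) a ra) (Ref-target (π i) a′ ra′)
        (trans (sym (τ-suc i a)) (trans e (τ-suc i a′))))

    τg : ℕ → Fin G.nR → D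
    τg i r = τ i (Vec.lookup (pg (st i)) r)

    g-test : ∀ i → τg i , datum i ⊨ Tr.test (gtr (gδ (π i)))
    g-test i = reflects-true (evalTest-reflects (λ r → Step.holds-reflects i _ (inj₁ (r , refl))) (Tr.test (gtr (gδ (π i)))))
                             (Valid.test (valid i))

    τg-suc : ∀ i r → τg (suc i) r ≡ update (Tr.asgn (gtr (gδ (π i)))) (τg i) (datum i) r
    τg-suc i r =
      begin
        τ (suc i) (Vec.lookup (pg (st (suc i))) r)
      ≡⟨ cong (λ s → τ (suc i) (Vec.lookup (pg s) r)) (sym (target≡ i)) ⟩
        τ (suc i) (Vec.lookup (gPtrs′ (π i)) r)
      ≡⟨ τ-suc i _ ⟩
        Step.τ′ i (Vec.lookup (gPtrs′ (π i)) r)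
      ≡⟨ cong (Step.τ′ i) (lookup-repoint asgn (pg (st i)) (slot (π i)) r) ⟩
        Step.τ′ i (if asgn r then slot (π i) else Vec.lookup (pg (st i)) r)
      ≡⟨ by-cases (asgn r) ⟩
        (if asgn r then datum i else τg i r)
      ≡⟨ update-if asgn (τg i) (datum i) r ⟨
        update asgn (τg i) (datum i) r
      ∎
      where
      open ≡-Reasoning
      asgn = Tr.asgn (gtr (gδ (π i)))
      by-cases : ∀ b → Step.τ′ i (if b then slot (π i) else Vec.lookup (pg (st i)) r) ≡ (if b then datum i else τg i r)
      by-cases true  = Step.τ′-slot i
      by-cases false = Step.τ′-Ref i _ (inj₁ (r , refl))

    ρg : g.Run x
    ρg = record
      { state      = λ i → qg (st i)
      ; regs       = τg
      ; trans      = λ i → gtr (gδ (π i))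
      ; trans∈Δ    = λ i → ∈-lookup (gδ (π i))
      ; init-state = cong qg st-zero
      ; init-regs  = λ r → T.init-regs ρ _
      ; src-ok     = λ i → Valid.src (valid i)
      ; lab-ok     = λ i → trans (cong Tr.lab (sym (trans≡ i))) (T.lab-ok ρ i)
      ; test-ok    = g-test
      ; regs-ok    = τg-suc
      ; tgt-ok     = λ i → cong qg (target≡ i) }

    gAccepts fVisits : ℕ → Bool
    gAccepts i = G.F (qg (st i))
    fVisits  i = visited (fEnd (π i))

    module Fl = Flag gAccepts fVisits (λ i → flag (st i))
      (λ i → trans (cong flag (sym (target≡ i))) refl)

    decode-state : ∀ m → decode stateEnumeration (T.state ρ m) ≡ st m
    decode-state m = trans (cong (decode stateEnumeration) (trans (sym (T.src-ok ρ m)) (cong Tr.src (trans≡ m))))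
                           (decode-encode stateEnumeration (st m))

    often-flag : InfinitelyOften (λ m → flag (st m) ∧ gAccepts m)
    often-flag n = let (m , le , e) = acc n in
      m , le , subst (λ s → flag s ∧ G.F (qg s) ≡ true) (decode-state m) e

    accG : g.Accepting ρg
    accG = proj₁ (Fl.often-flag⇒often-both often-flag)

    often-fVisits : InfinitelyOften fVisits
    often-fVisits = proj₂ (Fl.often-flag⇒often-both often-flag)

    ptr-reflects : ∀ i {a b} → Ref⁺ (π i) a → Ref⁺ (π i) b → Reflects (τ (suc i) a ≡ τ (suc i) b) (a == b)
    ptr-reflects i {a} {b} ra rb = reflects-map (cong (τ (suc i)))
      (λ e → Step.distinct′ i a b ra rb (trans (sym (τ-suc i a)) (trans e (τ-suc i b)))) (==-reflects a b)

    M : ℕ → ℕ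
    M i = length (fMoves (π i))

    opaque
      outG : ℕ → List (Fin nB × D)
      outG = g.outAt ρg

      outG≡ : ∀ i → outG i ≡ g.outAt ρg i
      outG≡ i = refl

      length-outG : ∀ i → M i ≡ length (outG i)
      length-outG i = trans (length-zipWith _ (fδs (π i)) (gOut (π i)) (Valid.lengths (valid i)))
        (trans (length-map _ (Tr.out (gtr (gδ (π i))))) (sym (length-map _ (Tr.out (gtr (gδ (π i)))))))

      nth-outG : ∀ i j {m} → nth (fMoves (π i)) j ≡ just m → nth (outG i) j ≡ just (γ m , τ (suc i) (ptr m))
      nth-outG i j e with nth-fMoves⁻ (π i) j e
      ... | _ , r , e′ , refl = trans (nth-map _ (Tr.out (gtr (gδ (π i)))) j e′)
        (cong (λ s → just (_ , τ (suc i) (Vec.lookup (pg s) r))) (sym (target≡ i)))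

      unboundedG : Unbounded (prefixLen outG)
      unboundedG = infG x ρg accG

    y : ωWord (Fin nB × D)
    y = flatten outG unboundedG

    y-isConcat : IsConcatⁿ outG y
    y-isConcat = flatten-isConcat outG unboundedG

    P : ℕ → ℕ
    P = prefixLen outG

    P-suc : ∀ i → P (suc i) ≡ P i + M i
    P-suc i = cong (P i +_) (sym (length-outG i))

    conf : ℕ → ℕ → FConf
    conf i j = fconfAt (fStart (st i)) (fMoves (π i)) j

    σq : ℕ → ℕ → Fin H.nQ
    σq i j = q (conf i j)

    σr : ℕ → ℕ → Fin H.nR → D
    σr i j s = τ (suc i) (Vec.lookup (p (conf i j)) s)

    -- Position j of block i and position j′ of block i′ describe the same configuration of f.
    record Same (i j i′ j′ : ℕ) : Set where
      constructor same
      field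
        q-eq : σq i j ≡ σq i′ j′
        r-eq : ∀ s → σr i j s ≡ σr i′ j′ s
    open Same

    same-trans : ∀ {a b c d e f} → Same a b c d → Same c d e f → Same a b e f
    same-trans (same e₁ f₁) (same e₂ f₂) = same (trans e₁ e₂) (λ s → trans (f₁ s) (f₂ s))

    same-sym : ∀ {a b c d} → Same a b c d → Same c d a b
    same-sym (same e₁ f₁) = same (sym e₁) (λ s → sym (f₁ s))

    end≡start : ∀ i → Same i (M i) (suc i) 0
    end≡start i = same (cong qf (target≡ i)) (λ s → sym (
      begin
        τ (suc (suc i)) (Vec.lookup (pf (st (suc i))) s)
      ≡⟨ τ-suc (suc i) _ ⟩
        Step.τ′ (suc i) (Vec.lookup (pf (st (suc i))) s)
      ≡⟨ Step.τ′-Ref (suc i) _ (inj₂ (s , refl)) ⟩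
        τ (suc i) (Vec.lookup (pf (st (suc i))) s)
      ≡⟨ cong (λ t → τ (suc i) (Vec.lookup (pf t) s)) (target≡ i) ⟨
        σr i (M i) s
      ∎))
      where open ≡-Reasoning

    -- Blocks i+1, …, i+dl are empty.
    same-across-empty : ∀ dl i → P (suc i) ≡ P (suc i + dl) → Same i (M i) (suc i + dl) 0
    same-across-empty zero i e rewrite +-identityʳ i = end≡start i
    same-across-empty (suc dl) i e =
      same-trans (end≡start i) (subst (λ z → Same (suc i) z (suc i + suc dl) 0) M≡0
        (subst (λ z → Same (suc i) (M (suc i)) z 0) (sym (+-suc (suc i) dl)) (same-across-empty dl (suc i) e′)))
      where
      P≤ : P (suc (suc i)) ≤ P (suc i + suc dl)
      P≤ = prefixLen-mono outG (subst (suc (suc i) ≤_) (sym (+-suc (suc i) dl)) (s≤s (s≤s (m≤m+n i dl))))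
      M≡0 : M (suc i) ≡ 0
      M≡0 = +-cancelˡ-≡ (P (suc i)) (M (suc i)) 0 (trans
        (≤-antisym (subst (_≤ P (suc i)) (P-suc (suc i)) (≤-trans P≤ (≤-reflexive (sym e)))) (m≤m+n _ _))
        (sym (+-identityʳ _)))
      e′ : P (suc (suc i)) ≡ P (suc (suc i) + dl)
      e′ = trans (P-suc (suc i)) (trans (cong (P (suc i) +_) M≡0) (trans (+-identityʳ _)
             (trans e (cong P (+-suc (suc i) dl)))))

    same-position< : ∀ i j i′ j′ → i < i′ → P i + j ≡ P i′ + j′ → j ≤ M i → Same i j i′ j′
    same-position< i j i′ j′ lt e le with m≤n⇒∃[o]m+o≡n lt
    ... | dl , refl = subst (λ z → Same i z (suc i + dl) j′) (sym j≡M)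
                        (subst (Same i (M i) (suc i + dl)) (sym j′≡0) (same-across-empty dl i (sym P≡)))
      where
      a₁ : P i + j ≤ P (suc i)
      a₁ = subst (P i + j ≤_) (sym (P-suc i)) (+-monoʳ-≤ (P i) le)
      a₂ : P (suc i) ≤ P (suc i + dl)
      a₂ = prefixLen-mono outG (m≤m+n (suc i) dl)
      j′≡0 : j′ ≡ 0
      j′≡0 = n≤0⇒n≡0 (+-cancelˡ-≤ (P (suc i + dl)) j′ 0
               (subst (P (suc i + dl) + j′ ≤_) (sym (+-identityʳ _)) (≤-trans (≤-reflexive (sym e)) (≤-trans a₁ a₂))))
      P′≡ : P (suc i + dl) + j′ ≡ P (suc i + dl)
      P′≡ = trans (cong (P (suc i + dl) +_) j′≡0) (+-identityʳ _)
      P≡ : P (suc i + dl) ≡ P (suc i)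
      P≡ = ≤-antisym (subst (_≤ P (suc i)) (trans e P′≡) a₁) a₂
      j≡M : j ≡ M i
      j≡M = +-cancelˡ-≡ (P i) j (M i) (trans e (trans P′≡ (trans P≡ (P-suc i))))

    same-position : ∀ i j i′ j′ → P i + j ≡ P i′ + j′ → j ≤ M i → j′ ≤ M i′ → Same i j i′ j′
    same-position i j i′ j′ e le le′ with <-cmp i i′
    ... | tri< lt _ _ = same-position< i j i′ j′ lt e le
    ... | tri> _ _ gt = same-sym (same-position< i′ j′ i j gt (sym e) le′)
    ... | tri≈ _ refl _ with +-cancelˡ-≡ (P i) j j′ e
    ... | refl = same refl (λ _ → refl)

    blockOf : ∀ n → Block outG n
    blockOf n = block outG n (unboundedG n)

    bi bj : ℕ → ℕ
    bi n = proj₁ (blockOf n)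
    bj n = n ∸ P (bi n)

    bi+bj : ∀ n → P (bi n) + bj n ≡ n
    bi+bj n = m+[n∸m]≡n (proj₁ (proj₂ (blockOf n)))

    bj<M : ∀ n → bj n < M (bi n)
    bj<M n = +-cancelˡ-< (P (bi n)) (bj n) (M (bi n))
      (subst₂ _<_ (sym (bi+bj n)) (P-suc (bi n)) (proj₂ (proj₂ (blockOf n))))

    fMoveAt : ℕ → FMove
    fMoveAt n = proj₁ (<⇒nth (fMoves (π (bi n))) (bj n) (bj<M n))

    nth-fMoveAt : ∀ n → nth (fMoves (π (bi n))) (bj n) ≡ just (fMoveAt n)
    nth-fMoveAt n = proj₂ (<⇒nth (fMoves (π (bi n))) (bj n) (bj<M n))

    fStepOkAt : ∀ n → FStepOk (conf (bi n) (bj n)) (fMoveAt n)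
    fStepOkAt n = FRun⇒FStepOk (Valid.fRun (valid (bi n))) (bj n) (fMoveAt n) (nth-fMoveAt n)

    conf-suc : ∀ n → conf (bi n) (suc (bj n)) ≡ fstep (conf (bi n) (bj n)) (fMoveAt n)
    conf-suc n = fconfAt-suc _ _ (bj n) (fMoveAt n) (nth-fMoveAt n)

    same-next : ∀ n → Same (bi (suc n)) (bj (suc n)) (bi n) (suc (bj n))
    same-next n = same-position _ _ _ _ (trans (bi+bj (suc n)) (sym (trans (+-suc (P (bi n)) (bj n)) (cong suc (bi+bj n)))))
      (<⇒≤ (bj<M (suc n))) (bj<M n)

    y≡ : ∀ n → y n ≡ (γ (fMoveAt n) , τ (suc (bi n)) (ptr (fMoveAt n)))
    y≡ n = subst (λ z → y z ≡ (γ (fMoveAt n) , τ (suc (bi n)) (ptr (fMoveAt n)))) (bi+bj n) (proj₁ y-isConcat (bi n) (bj n) (nth-outG (bi n) (bj n) (nth-fMoveAt n)))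

    f-test : ∀ n → σr (bi n) (bj n) , proj₂ (y n) ⊨ Tr.test (ftr (δ (fMoveAt n)))
    f-test n rewrite y≡ n = reflects-true
      (evalTest-reflects (λ s → ptr-reflects (bi n) (fconfAt-Ref⁺ (π (bi n)) (bj n) s)
                                               (fMoves-Ref⁺ (π (bi n)) (bj n) _ (nth-fMoveAt n)))
                         (Tr.test (ftr (δ (fMoveAt n)))))
      (FStepOk.test (fStepOkAt n))

    σr-suc : ∀ n s → σr (bi (suc n)) (bj (suc n)) s ≡ update (Tr.asgn (ftr (δ (fMoveAt n)))) (σr (bi n) (bj n)) (proj₂ (y n)) s
    σr-suc n s rewrite y≡ n =
      begin
        σr (bi (suc n)) (bj (suc n)) s
      ≡⟨ r-eq (same-next n) s ⟩
        τ (suc i) (Vec.lookup (p (conf i (suc (bj n)))) s)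
      ≡⟨ cong (λ c → τ (suc i) (Vec.lookup (p c) s)) (conf-suc n) ⟩
        τ (suc i) (Vec.lookup (repoint asgn (p (conf i (bj n))) (ptr (fMoveAt n))) s)
      ≡⟨ cong (τ (suc i)) (lookup-repoint asgn (p (conf i (bj n))) (ptr (fMoveAt n)) s) ⟩
        τ (suc i) (if asgn s then ptr (fMoveAt n) else Vec.lookup (p (conf i (bj n))) s)
      ≡⟨ by-cases (asgn s) ⟩
        (if asgn s then τ (suc i) (ptr (fMoveAt n)) else σr i (bj n) s)
      ≡⟨ update-if asgn (σr i (bj n)) _ s ⟨
        update asgn (σr i (bj n)) (τ (suc i) (ptr (fMoveAt n))) s
      ∎
      where
      open ≡-Reasoning
      i = bi n
      asgn = Tr.asgn (ftr (δ (fMoveAt n)))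
      by-cases : ∀ b → τ (suc i) (if b then ptr (fMoveAt n) else Vec.lookup (p (conf i (bj n))) s) ≡
                       (if b then τ (suc i) (ptr (fMoveAt n)) else σr i (bj n) s)
      by-cases true  = refl
      by-cases false = refl

    same-zero : Same (bi 0) (bj 0) 0 0
    same-zero = same-position _ _ _ _ (bi+bj 0) (<⇒≤ (bj<M 0)) z≤n

    ρf : f.Run y
    ρf = record
      { state      = λ n → σq (bi n) (bj n)
      ; regs       = λ n → σr (bi n) (bj n)
      ; trans      = λ n → ftr (δ (fMoveAt n))
      ; trans∈Δ    = λ n → ∈-lookup (δ (fMoveAt n))
      ; init-state = trans (q-eq same-zero) (cong qf st-zero)
      ; init-regs  = λ s → trans (r-eq same-zero s)
                      (trans (τ-suc 0 _) (trans (Step.τ′-Ref 0 _ (inj₂ (s , refl))) (T.init-regs ρ _)))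
      ; src-ok     = λ n → FStepOk.src (fStepOkAt n)
      ; lab-ok     = λ n → trans (FStepOk.lab (fStepOkAt n)) (cong proj₁ (sym (y≡ n)))
      ; test-ok    = f-test
      ; regs-ok    = σr-suc
      ; tgt-ok     = λ n → sym (trans (q-eq (same-next n)) (cong q (conf-suc n))) }

    accF : f.Accepting ρf
    accF n with unboundedG n
    ... | i₀ , lt₀ with often-fVisits i₀
    ... | m , le , ev with visited⇒accepting (fStart (st m)) (fMoves (π m)) (M m) ev
    ... | inj₂ (j′ , lt , acc′) = pos , n≤pos , subst (λ z → H.F z ≡ true) (sym (q-eq same-pos)) acc′
      where
      pos = P m + suc j′
      same-pos : Same (bi pos) (bj pos) m (suc j′)
      same-pos = same-position _ _ _ _ (bi+bj pos) (<⇒≤ (bj<M pos)) lt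
      n≤pos : n ≤ pos
      n≤pos = ≤-trans (<⇒≤ lt₀) (≤-trans (prefixLen-mono outG le) (m≤m+n (P m) (suc j′)))

    value : ℕ → Fin nC × Fin K → Fin nC × D
    value i (γ′ , a) = γ′ , τ (suc i) a

    outAt≡ : ∀ n → f.outAt ρf n ≡ map (value (bi n)) (moveOutput (conf (bi n) (bj n)) (fMoveAt n))
    outAt≡ n = trans (map-cong (λ (γ′ , s) → cong (γ′ ,_) (trans (r-eq (same-next n) s)
                        (cong (λ c → τ (suc (bi n)) (Vec.lookup (p c) s)) (conf-suc n)))) (Tr.out (ftr (δ (fMoveAt n)))))
                      (map-∘ (Tr.out (ftr (δ (fMoveAt n)))))

    outAt-block : ∀ i j m → nth (fMoves (π i)) j ≡ just m → map (value i) (moveOutput (conf i j) m) ≡ f.outAt ρf (P i + j)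
    outAt-block i j m e = trans (same-move (bi n) (bj n) (fMoveAt n) bi≡ bj≡ (nth-fMoveAt n)) (sym (outAt≡ n))
      where
      n = P i + j
      j<M : j < M i
      j<M = nth⇒< (fMoves (π i)) j e
      bi≡ : bi n ≡ i
      bi≡ = block-unique outG (proj₁ (proj₂ (blockOf n))) (proj₂ (proj₂ (blockOf n))) (m≤m+n (P i) j)
              (subst (n <_) (sym (P-suc i)) (+-monoʳ-< (P i) j<M))
      bj≡ : bj n ≡ j
      bj≡ = trans (cong (λ z → n ∸ P z) bi≡) (m+n∸m≡n (P i) j)
      same-move : ∀ i′ j′ m′ → i′ ≡ i → j′ ≡ j → nth (fMoves (π i′)) j′ ≡ just m′ →
                  map (value i) (moveOutput (conf i j) m) ≡ map (value i′) (moveOutput (conf i′ j′) m′)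
      same-move i′ j′ m′ refl refl e′ with trans (sym e) e′
      ... | refl = refl

    outT≡regroup : ∀ i → T.outAt ρ i ≡ regroup (f.outAt ρf) outG i
    outT≡regroup i = trans (cong (λ tr → map (value i) (Tr.out tr)) (trans≡ i))
      (trans (map-fOutput (value i) (f.outAt ρf) (fStart (st i)) (fMoves (π i)) (P i) (outAt-block i))
        (cong (concatRange (f.outAt ρf) (P i)) (length-outG i)))

    outputs-infinite : InfiniteOutputs d₀ Tf → Unbounded (prefixLen (T.outAt ρ))
    outputs-infinite infF = proj₂ (IsConcatⁿ-cong {z = flatten (f.outAt ρf) unboundedF} (λ i → sym (outT≡regroup i))
      (regroup-isConcat⁺ (f.outAt ρf) outG (flatten (f.outAt ρf) unboundedF) unboundedG (flatten-isConcat (f.outAt ρf) unboundedF)))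
      where
      unboundedF = infF y ρf accF

    decompose : ∀ z → IsConcat (T.outAt ρ) z → ∃[ y′ ] (⟦ d₀ ⟧[ Tg ] x y′ × ⟦ d₀ ⟧[ Tf ] y′ z)
    decompose z ic =
      y , (ρg , accG , IsConcatⁿ⇒IsConcat {y = y} (IsConcatⁿ-cong {z = y} outG≡ y-isConcat)) ,
          (ρf , accF , IsConcatⁿ⇒IsConcat {y = z} (regroup-isConcat⁻ (f.outAt ρf) outG z unboundedG
                                              (IsConcatⁿ-cong {z = z} outT≡regroup (IsConcat⇒IsConcatⁿ {y = z} ic))))

-- Completeness

module Completeness {D : Set} (d₀ : D) (_≟ᴰ_ : DecidableEquality D) {nA nB nC : ℕ} (Tg : NRT nA nB) (Tf : NRT nB nC) where
  open Composition Tg Tf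
  open CompositionProperties Tg Tf
  open RegisterInvariant {D} Tg Tf
  module T = Semantics d₀ composition
  module g = Semantics d₀ Tg
  module f = Semantics d₀ Tf

  chooseSlot : State → (Fin K → D) → D → Bool × Fin K
  chooseSlot st τ d with any? (λ a → Ref? st a ×-dec τ a ≟ᴰ d)
  ... | yes (a , _) = true , a
  ... | no _        = false , proj₁ (freeSlot st)

  chooseSlot-ok : ∀ st τ d → SlotOk st (proj₁ (chooseSlot st τ d)) (proj₂ (chooseSlot st τ d)) ×
                             τ , d ⊨ slotTest st (proj₁ (chooseSlot st τ d)) (proj₂ (chooseSlot st τ d))
  chooseSlot-ok st τ d with any? (λ a → Ref? st a ×-dec τ a ≟ᴰ d)
  ... | yes (a , ra , e) = ra , e
  ... | no none          = proj₂ (freeSlot st) , freshTest-complete st τ d (proj₁ (freeSlot st)) (λ a ra e → none (a , ra , e))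

  module _ (x : ωWord (Fin nA × D)) (ρg : g.Run x) (accg : g.Accepting ρg) (y : ωWord (Fin nB × D))
           (icg : IsConcat (g.outAt ρg) y) (ρf : f.Run y) (accf : f.Accepting ρf) (z : ωWord (Fin nC × D))
           (icf : IsConcat (f.outAt ρf) z) where

    datum : ℕ → D
    datum i = proj₂ (x i)

    gIndex : ℕ → Fin (length G.Δ)
    gIndex i = index (g.trans∈Δ ρg i)

    gIndex-ok : ∀ i → gtr (gIndex i) ≡ g.trans ρg i
    gIndex-ok i = sym (lookup-index (g.trans∈Δ ρg i))

    fIndex : ℕ → Fin (length H.Δ)
    fIndex n = index (f.trans∈Δ ρf n)

    fIndex-ok : ∀ n → ftr (fIndex n) ≡ f.trans ρf n
    fIndex-ok n = sym (lookup-index (f.trans∈Δ ρf n))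

    opaque
      outG : ℕ → List (Fin nB × D)
      outG = g.outAt ρg

      outG≡ : ∀ i → outG i ≡ g.outAt ρg i
      outG≡ i = refl

    P : ℕ → ℕ
    P = prefixLen outG

    mG : ℕ → ℕ
    mG i = length (Tr.out (g.trans ρg i))

    opaque
      unfolding outG
      length-outG : ∀ i → length (outG i) ≡ mG i
      length-outG i = length-map _ (Tr.out (g.trans ρg i))

    fδsAt : ℕ → List (Fin (length H.Δ))
    fδsAt i = applyUpTo (λ j → fIndex (P i + j)) (mG i)

    step : ℕ → State × (Fin K → D) → State × (Fin K → D)
    step i (s , τ) = let (seen , k) = chooseSlot s τ (datum i) in
      target (choice s (gIndex i) seen k (fδsAt i)) , update (slotAsgn seen k) τ (datum i)

    conf : ℕ → State × (Fin K → D)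
    conf zero    = start , (λ _ → d₀)
    conf (suc i) = step i (conf i)

    st : ℕ → State
    st i = proj₁ (conf i)

    τ : ℕ → Fin K → D
    τ i = proj₂ (conf i)

    π : ℕ → Choice
    π i = choice (st i) (gIndex i) (proj₁ (chooseSlot (st i) (τ i) (datum i))) (proj₂ (chooseSlot (st i) (τ i) (datum i))) (fδsAt i)

    record Simulates (i : ℕ) : Set where
      field
        qg≡      : qg (st i) ≡ g.state ρg i
        pg≡      : ∀ r → τ i (Vec.lookup (pg (st i)) r) ≡ g.regs ρg i r
        qf≡      : qf (st i) ≡ f.state ρf (P i)
        pf≡      : ∀ s → τ i (Vec.lookup (pf (st i)) s) ≡ f.regs ρf (P i) s
        distinct : Distinct (st i) (τ i)
    open Simulates

    simulates-zero : Simulates 0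
    simulates-zero = record
      { qg≡      = sym (g.init-state ρg)
      ; pg≡      = λ r → sym (g.init-regs ρg r)
      ; qf≡      = sym (f.init-state ρf)
      ; pf≡      = λ s → sym (f.init-regs ρf s)
      ; distinct = λ a a′ ra ra′ _ → trans (Ref-start a ra) (sym (Ref-start a′ ra′)) }

    module Step (i : ℕ) (sim : Simulates i) where
      slotChoice = chooseSlot-ok (st i) (τ i) (datum i)
      open SlotStep (st i) (τ i) (datum i) (seen (π i)) (slot (π i)) (distinct sim) (proj₁ slotChoice) (proj₂ slotChoice) public

      gPtrs′≡ : ∀ r → τ (suc i) (Vec.lookup (gPtrs′ (π i)) r) ≡ g.regs ρg (suc i) r
      gPtrs′≡ r =
        begin
          τ′ (Vec.lookup (repoint asgn (pg (st i)) (slot (π i))) r)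
        ≡⟨ cong τ′ (lookup-repoint asgn (pg (st i)) (slot (π i)) r) ⟩
          τ′ (if asgn r then slot (π i) else Vec.lookup (pg (st i)) r)
        ≡⟨ by-cases (asgn r) ⟩
          (if asgn r then datum i else g.regs ρg i r)
        ≡⟨ update-if asgn (g.regs ρg i) (datum i) r ⟨
          update asgn (g.regs ρg i) (datum i) r
        ≡⟨ cong (λ tr → update (Tr.asgn tr) (g.regs ρg i) (datum i) r) (gIndex-ok i) ⟩
          update (Tr.asgn (g.trans ρg i)) (g.regs ρg i) (datum i) r
        ≡⟨ g.regs-ok ρg i r ⟨
          g.regs ρg (suc i) r
        ∎
        where
        open ≡-Reasoning
        asgn = Tr.asgn (gtr (gIndex i))
        by-cases : ∀ b → τ′ (if b then slot (π i) else Vec.lookup (pg (st i)) r) ≡ (if b then datum i else g.regs ρg i r)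
        by-cases true  = τ′-slot
        by-cases false = trans (τ′-Ref _ (inj₁ (r , refl))) (pg≡ sim r)

      length-gOut : length (gOut (π i)) ≡ mG i
      length-gOut = trans (length-map _ (Tr.out (gtr (gIndex i)))) (cong (λ tr → length (Tr.out tr)) (gIndex-ok i))

      lengths : length (fδs (π i)) ≡ length (gOut (π i))
      lengths = trans (length-applyUpTo _ (mG i)) (sym length-gOut)

      length-fMoves : length (fMoves (π i)) ≡ mG i
      length-fMoves = trans (length-zipWith _ (fδs (π i)) (gOut (π i)) lengths) length-gOut

      nth-fMoves : ∀ j → j < mG i → Σ FMove λ m → nth (fMoves (π i)) j ≡ just m × δ m ≡ fIndex (P i + j) ×
                   y (P i + j) ≡ (γ m , τ (suc i) (ptr m))
      nth-fMoves j lt = fmove (fIndex (P i + j)) (proj₁ γr) (Vec.lookup (gPtrs′ (π i)) (proj₂ γr)) , nth-m , refl , y≡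
        where
        found = <⇒nth (Tr.out (g.trans ρg i)) j lt
        γr = proj₁ found
        nth-out : nth (Tr.out (gtr (gIndex i))) j ≡ just γr
        nth-out = subst (λ tr → nth (Tr.out tr) j ≡ just γr) (sym (gIndex-ok i)) (proj₂ found)
        nth-m = nth-zipWith⁺ _ (fδs (π i)) (gOut (π i)) j (nth-applyUpTo _ lt) (nth-map _ (Tr.out (gtr (gIndex i))) j nth-out)
        y≡ = trans (cong (λ X → y (X + j)) (prefixLen-cong outG≡ i))
               (trans (proj₁ (IsConcat⇒IsConcatⁿ {y = y} icg) i j (nth-map _ (Tr.out (g.trans ρg i)) j (proj₂ found)))
                      (cong (proj₁ γr ,_) (sym (gPtrs′≡ (proj₂ γr)))))

      innerConf : ℕ → FConf
      innerConf j = fconfAt (fStart (st i)) (fMoves (π i)) j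

      FSimulates : ℕ → Set
      FSimulates j = q (innerConf j) ≡ f.state ρf (P i + j) ×
                     (∀ s → τ (suc i) (Vec.lookup (p (innerConf j)) s) ≡ f.regs ρf (P i + j) s)

      fsimulates : ∀ j → j ≤ mG i → FSimulates j
      fsimulates zero _ = subst (λ n → q (innerConf 0) ≡ f.state ρf n × (∀ s → τ (suc i) (Vec.lookup (p (innerConf 0)) s) ≡ f.regs ρf n s))
        (sym (+-identityʳ (P i))) (qf≡ sim , λ s → trans (τ′-Ref _ (inj₂ (s , refl))) (pf≡ sim s))
      fsimulates (suc j) le with nth-fMoves j le
      ... | fmove _ γ c , e , refl , y≡ rewrite fconfAt-suc (fStart (st i)) (fMoves (π i)) j _ e =
        trans (cong Tr.tgt (fIndex-ok n)) (trans (f.tgt-ok ρf n) (cong (f.state ρf) (sym (+-suc (P i) j)))) ,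
        λ s → trans (regs≡ (ftr (fIndex n)) (fIndex-ok n) s) (cong (λ m → f.regs ρf m s) (sym (+-suc (P i) j)))
        where
        n = P i + j
        by-cases : ∀ s b → τ (suc i) (if b then c else Vec.lookup (p (innerConf j)) s) ≡ (if b then proj₂ (y n) else f.regs ρf n s)
        by-cases s true  = sym (cong proj₂ y≡)
        by-cases s false = proj₂ (fsimulates j (≤-trans (n≤1+n j) le)) s
        regs≡ : ∀ tr → tr ≡ f.trans ρf n → ∀ s →
                τ (suc i) (Vec.lookup (repoint (Tr.asgn tr) (p (innerConf j)) c) s) ≡ f.regs ρf (suc n) s
        regs≡ _ refl s = trans (cong (τ (suc i)) (lookup-repoint (Tr.asgn (f.trans ρf n)) (p (innerConf j)) c s))
          (trans (by-cases s (Tr.asgn (f.trans ρf n) s))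
            (sym (trans (f.regs-ok ρf n s) (update-if (Tr.asgn (f.trans ρf n)) (f.regs ρf n) (proj₂ (y n)) s))))

      fStepOk : ∀ j m → nth (fMoves (π i)) j ≡ just m → FStepOk (innerConf j) m
      fStepOk j m e with nth-fMoves j (subst (j <_) length-fMoves (nth⇒< (fMoves (π i)) j e))
      ... | fmove _ γ c , e′ , refl , y≡ with trans (sym e) e′
      ... | refl = record
        { src  = trans (cong Tr.src (fIndex-ok n)) (trans (f.src-ok ρf n) (sym (proj₁ sim-j)))
        ; lab  = trans (cong Tr.lab (fIndex-ok n)) (trans (f.lab-ok ρf n) (cong proj₁ y≡))
        ; test = true-reflects (evalTest-reflects reflects (Tr.test (ftr (fIndex n))))
                   (subst (λ tr → f.regs ρf n , proj₂ (y n) ⊨ Tr.test tr) (sym (fIndex-ok n)) (f.test-ok ρf n)) }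
        where
        n = P i + j
        sim-j = fsimulates j (<⇒≤ (subst (j <_) length-fMoves (nth⇒< (fMoves (π i)) j e)))
        reflects : ∀ s → Reflects (f.regs ρf n s ≡ proj₂ (y n)) (Vec.lookup (p (innerConf j)) s == c)
        reflects s = reflects-map
          (λ eq → trans (sym (proj₂ sim-j s)) (trans (cong (τ (suc i)) eq) (sym (cong proj₂ y≡))))
          (λ eq → distinct′ _ _ (fconfAt-Ref⁺ (π i) j s) (fMoves-Ref⁺ (π i) j _ e)
                    (trans (proj₂ sim-j s) (trans eq (cong proj₂ y≡))))
          (==-reflects _ c)

      valid : Valid (π i)
      valid = record
        { src    = trans (cong Tr.src (gIndex-ok i)) (trans (g.src-ok ρg i) (sym (qg≡ sim)))
        ; test   = true-reflects (evalTest-reflects reflects (Tr.test (gtr (gIndex i))))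
                     (subst (λ tr → g.regs ρg i , datum i ⊨ Tr.test tr) (sym (gIndex-ok i)) (g.test-ok ρg i))
        ; slotOk = proj₁ slotChoice
        ; lengths = lengths
        ; fRun   = FStepOk⇒FRun _ _ fStepOk }
        where
        reflects : ∀ r → Reflects (g.regs ρg i r ≡ datum i) (Vec.lookup (pg (st i)) r == slot (π i))
        reflects r = reflects-map (λ e → trans (sym (pg≡ sim r)) e) (λ e → trans (pg≡ sim r) e)
                                  (holds-reflects _ (inj₁ (r , refl)))

      simulates-suc : Simulates (suc i)
      simulates-suc = record
        { qg≡      = trans (cong Tr.tgt (gIndex-ok i)) (g.tgt-ok ρg i)
        ; pg≡      = gPtrs′≡
        ; qf≡      = trans (cong (λ j → q (innerConf j)) length-fMoves) (trans (proj₁ (fsimulates (mG i) ≤-refl)) (cong (f.state ρf) (sym P-suc)))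
        ; pf≡      = λ s → trans (cong (λ j → τ (suc i) (Vec.lookup (p (innerConf j)) s)) length-fMoves)
                       (trans (proj₂ (fsimulates (mG i) ≤-refl) s) (cong (λ m → f.regs ρf m s) (sym P-suc)))
        ; distinct = λ a a′ ra ra′ e → distinct′ a a′ (Ref-target (π i) a ra) (Ref-target (π i) a′ ra′) e }
        where
        P-suc : P (suc i) ≡ P i + mG i
        P-suc = cong (P i +_) (length-outG i)

    simulates : ∀ i → Simulates i
    simulates zero    = simulates-zero
    simulates (suc i) = Step.simulates-suc i (simulates i)

    length-fδsAt≤ : ∀ i → length (fδsAt i) ≤ maxOut
    length-fδsAt≤ i = subst (_≤ maxOut) (sym (length-applyUpTo _ (mG i)))
      (∈⇒≤sum (∈-map⁺ (λ tr → length (Tr.out tr)) (g.trans∈Δ ρg i)))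

    π∈choices : ∀ i → π i ∈ choices
    π∈choices i = ∈-map⁺ _ (∈-cartesianProduct⁺ (complete stateEnumeration (st i)) (∈-cartesianProduct⁺ (∈-allFin (gIndex i))
      (∈-cartesianProduct⁺ (complete boolEnumeration (seen (π i))) (∈-cartesianProduct⁺ (∈-allFin (slot (π i)))
        (listsUpTo-complete (finEnumeration _) maxOut (fδsAt i) (length-fδsAt≤ i))))))

    ρT : T.Run x
    ρT = record
      { state      = λ i → encode stateEnumeration (st i)
      ; regs       = τ
      ; trans      = λ i → transition (π i)
      ; trans∈Δ    = λ i → ∈-map⁺ transition (∈-filter⁺ valid? (π∈choices i) (Step.valid i (simulates i)))
      ; init-state = refl
      ; init-regs  = λ _ → refl
      ; src-ok     = λ i → refl
      ; lab-ok     = λ i → trans (cong Tr.lab (gIndex-ok i)) (g.lab-ok ρg i)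
      ; test-ok    = λ i → proj₂ (Step.slotChoice i (simulates i))
      ; regs-ok    = λ i a → refl
      ; tgt-ok     = λ i → refl }

    gAccepts fVisits : ℕ → Bool
    gAccepts i = G.F (qg (st i))
    fVisits  i = visited (fEnd (π i))

    module Fl = Flag gAccepts fVisits (λ i → flag (st i)) (λ i → refl)

    often-gAccepts : InfinitelyOften gAccepts
    often-gAccepts n = let (m , le , e) = accg n in m , le , trans (cong G.F (qg≡ (simulates m))) e

    unboundedP : Unbounded P
    unboundedP n = let (i , lt) = proj₂ icg n in i , subst (n <_) (sym (prefixLen-cong outG≡ i)) lt

    often-fVisits : InfinitelyOften fVisits
    often-fVisits n with accf (suc (P n))
    ... | suc u , s≤s le , ef with block outG u (unboundedP u)
    ... | i , le₁ , lt₁ = i , n≤i ,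
      accepting⇒visited (fStart (st i)) (fMoves (π i)) j (subst (j <_) (sym (Step.length-fMoves i (simulates i))) j<mG)
        (trans (cong H.F (proj₁ (Step.fsimulates i (simulates i) (suc j) j<mG))) (trans (cong (λ w → H.F (f.state ρf w)) P+j≡) ef))
      where
      j = u ∸ P i
      u≡ : P i + j ≡ u
      u≡ = m+[n∸m]≡n le₁
      j<mG : j < mG i
      j<mG = +-cancelˡ-< (P i) j (mG i) (subst₂ _<_ (sym u≡) (cong (P i +_) (length-outG i)) lt₁)
      P+j≡ : P i + suc j ≡ suc u
      P+j≡ = trans (+-suc (P i) j) (cong suc u≡)
      n≤i : n ≤ i
      n≤i with n ≤? i
      ... | yes le′ = le′
      ... | no ¬le  = ⊥-elim (<-irrefl refl (<-≤-trans lt₁ (≤-trans (prefixLen-mono outG (≰⇒> ¬le)) le)))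

    accT : T.Accepting ρT
    accT n = let (m , le , e) = Fl.often-both⇒often-flag often-gAccepts often-fVisits n in
      m , le , trans (cong (λ s → flag s ∧ G.F (qg s)) (decode-encode stateEnumeration (st m))) e

    value : ℕ → Fin nC × Fin K → Fin nC × D
    value i (γ′ , a) = γ′ , τ (suc i) a

    outAt-block : ∀ i j m → nth (fMoves (π i)) j ≡ just m → map (value i) (moveOutput (Step.innerConf i (simulates i) j) m) ≡ f.outAt ρf (P i + j)
    outAt-block i j m e with Step.nth-fMoves i (simulates i) j (subst (j <_) (Step.length-fMoves i (simulates i)) (nth⇒< (fMoves (π i)) j e))
    ... | fmove _ γ c , e′ , refl , _ with trans (sym e) e′
    ... | refl = trans (sym (map-∘ (Tr.out (ftr (fIndex n)))))
                   (trans (map-cong (λ (γ′ , s) → cong (γ′ ,_) (regs≡ s)) (Tr.out (ftr (fIndex n))))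
                     (cong (λ tr → map (λ (γ′ , s) → γ′ , f.regs ρf (suc n) s) (Tr.out tr)) (fIndex-ok n)))
      where
      n = P i + j
      cj = Step.innerConf i (simulates i) j
      j<mG : j < mG i
      j<mG = subst (j <_) (Step.length-fMoves i (simulates i)) (nth⇒< (fMoves (π i)) j e)
      regs≡ : ∀ s → τ (suc i) (Vec.lookup (p (fstep cj m)) s) ≡ f.regs ρf (suc n) s
      regs≡ s = trans (cong (λ c → τ (suc i) (Vec.lookup (p c) s)) (sym (fconfAt-suc (fStart (st i)) (fMoves (π i)) j m e)))
                  (trans (proj₂ (Step.fsimulates i (simulates i) (suc j) j<mG) s) (cong (λ w → f.regs ρf w s) (+-suc (P i) j)))

    outT≡regroup : ∀ i → T.outAt ρT i ≡ regroup (f.outAt ρf) outG i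
    outT≡regroup i = trans (map-fOutput (value i) (f.outAt ρf) (fStart (st i)) (fMoves (π i)) (P i) (outAt-block i))
      (cong (concatRange (f.outAt ρf) (P i)) (trans (Step.length-fMoves i (simulates i)) (sym (length-outG i))))

    compose : ⟦ d₀ ⟧[ composition ] x z
    compose = ρT , accT , IsConcatⁿ⇒IsConcat {y = z} (IsConcatⁿ-cong {z = z} (λ i → sym (outT≡regroup i))
      (regroup-isConcat⁺ (f.outAt ρf) outG z unboundedP (IsConcat⇒IsConcatⁿ {y = z} icf)))

theorem3 : (D : Set) (d₀ : D) → D ↔ ℕ → {nA nB nC : ℕ}
    → (Tg : NRT nA nB) → InfiniteOutputs d₀ Tg → Functional d₀ Tg
    → (Tf : NRT nB nC) → InfiniteOutputs d₀ Tf → Functional d₀ Tf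
    → Σ (NRT nA nC) λ T → InfiniteOutputs d₀ T
        × (∀ x z → ⟦ d₀ ⟧[ T ] x z ⇔ (∃[ y ] (⟦ d₀ ⟧[ Tg ] x y × ⟦ d₀ ⟧[ Tf ] y z)))
theorem3 D d₀ D↔ℕ Tg infG _ Tf infF _ =
  composition ,
  (λ x ρ acc → outputs-infinite x ρ acc infF) ,
  λ x z → mk⇔ (λ (ρ , acc , ic) → decompose x ρ acc z ic)
              (λ (y , (ρg , accg , icg) , (ρf , accf , icf)) → compose x ρg accg y icg ρf accf z icf)
  where
  open Composition Tg Tf
  open Soundness d₀ Tg Tf infG
  open Completeness d₀ (eq? (↔⇒↣ D↔ℕ)) Tg Tf
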